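{- Let $\mathcal{P}\subset\mathbb{R}^n$ be a Gorenstein polytope of index $k$, let $m$ be the unique lattice point in the relative interior of $k\mathcal{P}$, and let $p=\frac{1}{k}m$. Then $\operatorname{llenv}^p\operatorname{cone}\mathcal{P}=(\operatorname{lenv}^p\operatorname{cone}\mathcal{P})\cap\mathbb{Z}^{n+1}$.
   Context: A lattice polytope has vertices in $\mathbb{Z}^n$. For a polytope $\mathcal{P}\ni0$, $\mathcal{P}^\vee=\{\phi\in(\operatorname{lin}\mathcal{P})^*:\phi\le1\text{ on }\mathcal{P}\}$; $\mathcal{P}$ is reflexive if both $\mathcal{P}$ and $\mathcal{P}^\vee$ are lattice polytopes (the latter w.r.t. the dual lattice $\{\phi:\phi(a)\in\mathbb{Z}\ \forall a\in\operatorname{lin}\mathcal{P}\cap\mathbb{Z}^n\}$). A lattice polytope $\mathcal{P}$ is Gorenstein of index $k$ if there is a lattice point $m$ with $k\mathcal{P}-m$ reflexive. $\alpha(a)=(a,1)$; $\operatorname{cone}\mathcal{P}$ is the set of nonnegative multiples of elements of $\alpha(\mathcal{P})$. For a closed linear cone $\mathcal{C}$ not containing $-\alpha(p)$, $\epsilon^p_{\mathcal{C}}(x)=x-\max\{\lambda:x-\lambda\alpha(p)\in\mathcal{C}\}\alpha(p)$, $\operatorname{lenv}^p\mathcal{C}=\epsilon^p_{\mathcal{C}}(\mathcal{C})$, $\operatorname{llenv}^p\mathcal{C}=\epsilon^p_{\mathcal{C}}(\mathcal{C}\cap\mathbb{Z}^{n+1})$.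
   Formalization: Points of the ambient spaces, the shifts λ and the functionals of the dual polytope are rational, with ℚ^n and ℚ^(n+1) in place of ℝ^n and ℝ^(n+1). -}

module Defs where

open import Level using (0ℓ)
open import Data.Nat as ℕ using (ℕ; zero; suc; NonZero)
open import Data.Integer as ℤ using (ℤ)
open import Data.Rational using (ℚ; 0ℚ; 1ℚ; _+_; _*_; _-_; -_; _≤_; _<_; _/_)
open import Data.Fin using (Fin; zero; suc)
open import Data.Product using (Σ; ∃; _×_; _,_)
open import Function using (_∘_)
open import Relation.Binary.PropositionalEquality using (_≡_)

-- Points of ℚ^n (rational model of ℝ^n) and of ℤ^n.
Vecℚ : ℕ → Set
Vecℚ n = Fin n → ℚ

Vecℤ : ℕ → Set
Vecℤ n = Fin n → ℤ

Subset : ℕ → Set₁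
Subset n = Vecℚ n → Set

ℤ→ℚ : ℤ → ℚ
ℤ→ℚ z = z / 1

ι : ∀ {n} → Vecℤ n → Vecℚ n
ι z j = ℤ→ℚ (z j)

IsLattice : ∀ {n} → Vecℚ n → Set
IsLattice {n} x = Σ (Vecℤ n) λ z → ∀ j → x j ≡ ι z j

∑ : ∀ {r} → (Fin r → ℚ) → ℚ
∑ {zero} f = 0ℚ
∑ {suc r} f = f zero + ∑ (f ∘ suc)

⟪_,_⟫ : ∀ {n} → Vecℚ n → Vecℚ n → ℚ
⟪ φ , x ⟫ = ∑ (λ j → φ j * x j)

Conv : ∀ {n r} → (Fin r → Vecℚ n) → Subset n
Conv {n} {r} V x = Σ (Fin r → ℚ) λ c →
  (∀ i → 0ℚ ≤ c i) × (∑ c ≡ 1ℚ) × (∀ j → x j ≡ ∑ (λ i → c i * V i j))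

Lin : ∀ {n r} → (Fin r → Vecℚ n) → Subset n
Lin {n} {r} V x = Σ (Fin r → ℚ) λ c → ∀ j → x j ≡ ∑ (λ i → c i * V i j)

Aff : ∀ {n r} → (Fin r → Vecℚ n) → Subset n
Aff {n} {r} V x = Σ (Fin r → ℚ) λ c →
  (∑ c ≡ 1ℚ) × (∀ j → x j ≡ ∑ (λ i → c i * V i j))

RelInt : ∀ {n r} → (Fin r → Vecℚ n) → Subset n
RelInt {n} V x = Conv V x × Σ ℚ λ δ → (0ℚ < δ) ×
  (∀ (y : Vecℚ n) → Aff V y → (∀ j → (- δ < y j - x j) × (y j - x j < δ)) → Conv V y)

latticePts : ∀ {n r} → (Fin r → Vecℤ n) → Fin r → Vecℚ n
latticePts V i = ι (V i)

-- Dual lattice of lin(conv V): functionals on lin(conv V) (represented by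
-- any extension φ ∈ ℚ^n) taking integer values on lin(conv V) ∩ ℤ^n.
InDualLattice : ∀ {n r} → (Fin r → Vecℚ n) → Vecℚ n → Set
InDualLattice {n} V φ = ∀ (a : Vecℚ n) → Lin V a → IsLattice a →
  Σ ℤ λ z → ⟪ φ , a ⟫ ≡ ℤ→ℚ z

-- Q = conv V is reflexive: 0 ∈ Q, Q is a lattice polytope, and
-- Q^∨ = {φ ∈ (lin Q)^* : φ ≤ 1 on Q} is a lattice polytope w.r.t. the dual
-- lattice, i.e. Q^∨ = conv(Φ) for finitely many dual-lattice points Φ.
-- Elements of (lin Q)^* are represented by extensions ψ ∈ ℚ^n; two such
-- represent the same functional iff they agree on lin Q.
IsReflexive : ∀ {n r} → (Fin r → Vecℤ n) → Set
IsReflexive {n} {r} V =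
  Conv Q (λ _ → 0ℚ) ×
  Σ ℕ λ s → Σ (Fin s → Vecℚ n) λ Φ →
    (∀ i → InDualLattice Q (Φ i)) ×
    (∀ (ψ : Vecℚ n) →
      ((∀ x → Conv Q x → ⟪ ψ , x ⟫ ≤ 1ℚ) →
         Σ (Vecℚ n) λ φ → Conv Φ φ × (∀ x → Lin Q x → ⟪ ψ , x ⟫ ≡ ⟪ φ , x ⟫))
      × ((Σ (Vecℚ n) λ φ → Conv Φ φ × (∀ x → Lin Q x → ⟪ ψ , x ⟫ ≡ ⟪ φ , x ⟫)) →
         (∀ x → Conv Q x → ⟪ ψ , x ⟫ ≤ 1ℚ)))
  where
  Q : Fin r → Vecℚ n
  Q = latticePts V

shiftScale : ∀ {n r} → ℕ → Vecℤ n → (Fin r → Vecℤ n) → Fin r → Vecℤ n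
shiftScale k m V i j = ℤ.+ k ℤ.* V i j ℤ.- m j

scale : ∀ {n r} → ℕ → (Fin r → Vecℤ n) → Fin r → Vecℤ n
scale k V i j = ℤ.+ k ℤ.* V i j

IsGorensteinOfIndex : ∀ {n r} → (Fin r → Vecℤ n) → ℕ → Set
IsGorensteinOfIndex {n} V k = Σ (Vecℤ n) λ m → IsReflexive (shiftScale k m V)

-- α(a) = (a , 1) ∈ ℚ^(n+1)  (last coordinate 1)
snoc : ∀ {n} → Vecℚ n → ℚ → Vecℚ (suc n)
snoc {zero} f c zero = c
snoc {suc n} f c zero = f zero
snoc {suc n} f c (suc i) = snoc (f ∘ suc) c i

α : ∀ {n} → Vecℚ n → Vecℚ (suc n)
α a = snoc a 1ℚ

ConeOf : ∀ {n r} → (Fin r → Vecℚ n) → Subset (suc n)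
ConeOf {n} V x = Σ ℚ λ t → Σ (Vecℚ n) λ a →
  (0ℚ ≤ t) × Conv V a × (∀ j → x j ≡ t * α a j)

shiftDown : ∀ {n} → Vecℚ (suc n) → ℚ → Vecℚ n → Vecℚ (suc n)
shiftDown x l p j = x j - l * α p j

IsEps : ∀ {n} → Subset (suc n) → Vecℚ n → Vecℚ (suc n) → Vecℚ (suc n) → Set
IsEps C p x y = Σ ℚ λ l →
  C (shiftDown x l p) × (∀ μ → C (shiftDown x μ p) → μ ≤ l) ×
  (∀ j → y j ≡ shiftDown x l p j)

Lenv : ∀ {n} → Subset (suc n) → Vecℚ n → Subset (suc n)
Lenv {n} C p y = Σ (Vecℚ (suc n)) λ x → C x × IsEps C p x y

LLenv : ∀ {n} → Subset (suc n) → Vecℚ n → Subset (suc n)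
LLenv {n} C p y = Σ (Vecℚ (suc n)) λ x → C x × IsLattice x × IsEps C p x y

-- The inclusion ⊇ holds because a point of the lower envelope is its own
-- envelope point (`lenv-fixed`).  For ⊆ let x be a lattice point of the cone
-- and Y = x - l·α(p) its envelope point, l maximal; let kP - m′ = conv q be
-- the reflexive translate provided by the Gorenstein condition.
--  1. m = m′ (`interior-point`): for a lattice point w in the relative interior
--     of a reflexive polytope every facet functional is an integer < 1 on w,
--     hence ≤ 0, and this forces w = 0.
--  2. By Farkas' lemma, maximality of l gives a linear form ψ ≥ 0 on the cone,
--     positive on α(p) and zero at Y (`maximal-shift-separator`,
--     `separator-vanishes`); dehomogenised, it supports kP - m′ at K·a - m′,
--     where Y = t·α(a) (`dehomogenise`).
--  3. Reflexivity replaces it by a facet functional Φ that is integral on the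
--     lattice and equals 1 at K·a - m′ and at a vertex q_i (`supporting-facet`,
--     `tight-vertex`).  Evaluating Φ shows l ∈ kℤ (`shift-is-integral`), so Y
--     is a lattice point (`integer-shift`, `envelope-lattice`).

module Submission where

open import Defs
open import Data.Nat using (ℕ; suc; NonZero)
open import Data.Integer using (ℤ)
open import Data.Rational using (ℚ; _/_)
open import Data.Fin using (Fin)
open import Data.Product using (_×_)

import Data.Nat as ℕ
open import Data.Nat using (zero)
import Data.Integer as Z
import Data.Integer.Properties as ZP
import Data.Integer.Tactic.RingSolver as ZS
import Data.Rational as Q
open Q using (0ℚ; 1ℚ; _+_; _*_; _-_; -_; _≤_; _<_; 1/_; ∣_∣)
import Data.Rational.Properties as QP
import Data.Rational.Unnormalised as U
import Data.Rational.Unnormalised.Properties as UP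
open import Data.Fin using (zero; suc; inject₁; fromℕ)
open import Data.Product using (Σ; _,_; proj₁; proj₂)
open import Data.Sum using (_⊎_; inj₁; inj₂)
import Data.Sum as Sum
open import Data.Empty using (⊥; ⊥-elim; ⊥-elim-irr)
open import Relation.Nullary using (Dec; yes; no)
open import Relation.Binary.PropositionalEquality
open import Function using (_∘_)
open import Data.Maybe using (Maybe; just; nothing)
open import Tactic.RingSolver using (solve-∀)
open import Tactic.RingSolver.Core.AlmostCommutativeRing
  using (AlmostCommutativeRing; fromCommutativeRing)

ℚ-ring : AlmostCommutativeRing _ _
ℚ-ring = fromCommutativeRing QP.+-*-commutativeRing isZero
  where
  isZero : ∀ x → Maybe (0ℚ ≡ x)
  isZero x with x QP.≟ 0ℚ
  ... | yes x≡0 = just (sym x≡0)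
  ... | no _ = nothing

0≤+ : ∀ {a b} → 0ℚ ≤ a → 0ℚ ≤ b → 0ℚ ≤ a + b
0≤+ pa pb = subst₂ _≤_ (QP.+-identityˡ 0ℚ) refl (QP.+-mono-≤ pa pb)

0<+ : ∀ {a b} → 0ℚ < a → 0ℚ ≤ b → 0ℚ < a + b
0<+ pa pb = subst₂ _<_ (QP.+-identityˡ 0ℚ) refl (QP.+-mono-<-≤ pa pb)

0≤* : ∀ {a b} → 0ℚ ≤ a → 0ℚ ≤ b → 0ℚ ≤ a * b
0≤* {a} {b} pa pb = QP.nonNegative⁻¹ (a * b)
  {{QP.nonNeg*nonNeg⇒nonNeg a {{Q.nonNegative pa}} b {{Q.nonNegative pb}}}}

0<* : ∀ {a b} → 0ℚ < a → 0ℚ < b → 0ℚ < a * b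
0<* {a} {b} pa pb = QP.positive⁻¹ (a * b)
  {{QP.pos*pos⇒pos a {{Q.positive pa}} b {{Q.positive pb}}}}

<0*<0 : ∀ {a b} → a < 0ℚ → b < 0ℚ → 0ℚ < a * b
<0*<0 {a} {b} pa pb = QP.positive⁻¹ (a * b)
  {{QP.neg*neg⇒pos a {{Q.negative pa}} b {{Q.negative pb}}}}

0≤² : ∀ a → 0ℚ ≤ a * a
0≤² a with QP.≤-total 0ℚ a
... | inj₁ 0≤a = 0≤* 0≤a 0≤a
... | inj₂ a≤0 = QP.nonNegative⁻¹ (a * a)
  {{QP.nonPos*nonPos⇒nonPos a {{Q.nonPositive a≤0}} a {{Q.nonPositive a≤0}}}}

≤⇒0≤- : ∀ {a b} → a ≤ b → 0ℚ ≤ b - a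
≤⇒0≤- {a} {b} h = subst₂ _≤_ (QP.+-inverseʳ a) refl (QP.+-monoˡ-≤ (- a) h)

0≤-⇒≤ : ∀ {a b} → 0ℚ ≤ b - a → a ≤ b
0≤-⇒≤ {a} {b} h = subst₂ _≤_ (QP.+-identityˡ a) (cancel a b) (QP.+-monoˡ-≤ a h)
  where cancel : ∀ a b → (b - a) + a ≡ b
        cancel = solve-∀ ℚ-ring

0<-⇒< : ∀ {a b} → 0ℚ < b - a → a < b
0<-⇒< {a} {b} h = subst₂ _<_ (QP.+-identityˡ a) (cancel a b) (QP.+-monoˡ-< a h)
  where cancel : ∀ a b → (b - a) + a ≡ b
        cancel = solve-∀ ℚ-ring

0≤-⇒≤0 : ∀ {a} → 0ℚ ≤ - a → a ≤ 0ℚ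
0≤-⇒≤0 {a} h = subst₂ _≤_ (neg-neg a) refl (QP.neg-antimono-≤ h)
  where neg-neg : ∀ a → - - a ≡ a
        neg-neg = solve-∀ ℚ-ring

-<0⇒0< : ∀ {a} → - a < 0ℚ → 0ℚ < a
-<0⇒0< {a} h = subst₂ _<_ refl (neg-neg a) (QP.neg-antimono-< h)
  where neg-neg : ∀ a → - - a ≡ a
        neg-neg = solve-∀ ℚ-ring

≤<⇒⊥ : ∀ {a b} → a ≤ b → b < a → ⊥
≤<⇒⊥ a≤b b<a = QP.<-irrefl refl (QP.≤-<-trans a≤b b<a)

0<1 : 0ℚ < 1ℚ
0<1 = Q.*<* (Z.+<+ (ℕ.s≤s ℕ.z≤n))

0<⇒≢0 : ∀ {a} → 0ℚ < a → a ≢ 0ℚ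
0<⇒≢0 h refl = QP.<-irrefl refl h

0≤∧≢0⇒0< : ∀ {a} → 0ℚ ≤ a → a ≢ 0ℚ → 0ℚ < a
0≤∧≢0⇒0< {a} h a≢0 with a QP.≤? 0ℚ
... | yes a≤0 = ⊥-elim (a≢0 (QP.≤-antisym a≤0 h))
... | no a≰0 = QP.≰⇒> a≰0

inv : (a : ℚ) → a ≢ 0ℚ → ℚ
inv a a≢0 = 1/_ a {{Q.≢-nonZero a≢0}}

*-inv : (a : ℚ) (a≢0 : a ≢ 0ℚ) → a * inv a a≢0 ≡ 1ℚ
*-inv a a≢0 = QP.*-inverseʳ a {{Q.≢-nonZero a≢0}}

inv-pos : (a : ℚ) (a≢0 : a ≢ 0ℚ) → 0ℚ < a → 0ℚ < inv a a≢0
inv-pos a a≢0 h = QP.positive⁻¹ _ {{QP.1/pos⇒pos a {{Q.positive h}}}}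

inv-neg : (a : ℚ) (a≢0 : a ≢ 0ℚ) → a < 0ℚ → inv a a≢0 < 0ℚ
inv-neg a a≢0 h = QP.negative⁻¹ _ {{QP.1/neg⇒neg a {{Q.negative h}}}}

-nonneg-≤ : ∀ {a b} → 0ℚ ≤ b → a - b ≤ a
-nonneg-≤ {a} {b} 0≤b = 0≤-⇒≤ (subst (0ℚ ≤_) (sym (cancel a b)) 0≤b)
  where cancel : ∀ a b → a - (a - b) ≡ b
        cancel = solve-∀ ℚ-ring

0<*≤0⇒≤0 : ∀ {t x} → 0ℚ < t → t * x ≤ 0ℚ → x ≤ 0ℚ
0<*≤0⇒≤0 {t} {x} 0<t h with x QP.≤? 0ℚ
... | yes x≤0 = x≤0
... | no x≰0 = ⊥-elim (≤<⇒⊥ h (0<* 0<t (QP.≰⇒> x≰0)))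

*≡0⇒≡0 : ∀ {d u} → d ≢ 0ℚ → d * u ≡ 0ℚ → u ≡ 0ℚ
*≡0⇒≡0 {d} {u} d≢0 du≡0 = begin
  u              ≡⟨ sym (QP.*-identityʳ u) ⟩
  u * 1ℚ         ≡⟨ cong (u *_) (sym (*-inv d d≢0)) ⟩
  u * (d * d⁻¹)  ≡⟨ reassoc u d d⁻¹ ⟩
  (d * u) * d⁻¹  ≡⟨ cong (_* d⁻¹) du≡0 ⟩
  0ℚ * d⁻¹       ≡⟨ QP.*-zeroˡ d⁻¹ ⟩
  0ℚ             ∎
  where open ≡-Reasoning
        d⁻¹ = inv d d≢0
        reassoc : ∀ u d e → u * (d * e) ≡ (d * u) * e
        reassoc = solve-∀ ℚ-ring

²≡0⇒≡0 : ∀ {a} → a * a ≡ 0ℚ → a ≡ 0ℚ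
²≡0⇒≡0 {a} h with a QP.≟ 0ℚ
... | yes a≡0 = a≡0
... | no a≢0 = *≡0⇒≡0 a≢0 h

-‿cancelʳ : ∀ {a b c} → a - c ≡ b - c → a ≡ b
-‿cancelʳ {a} {b} {c} h = begin
  a             ≡⟨ add-sub a c ⟩
  (a - c) + c   ≡⟨ cong (_+ c) h ⟩
  (b - c) + c   ≡⟨ sym (add-sub b c) ⟩
  b             ∎
  where open ≡-Reasoning
        add-sub : ∀ a b → a ≡ (a - b) + b
        add-sub = solve-∀ ℚ-ring

-0≡0⇒≡ : ∀ {a b} → a - b ≡ 0ℚ → a ≡ b
-0≡0⇒≡ {a} {b} h = -‿cancelʳ (trans h (sym (QP.+-inverseʳ b)))

∑-cong : ∀ {r} {f g : Fin r → ℚ} → (∀ i → f i ≡ g i) → ∑ f ≡ ∑ g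
∑-cong {zero} h = refl
∑-cong {suc r} h = cong₂ _+_ (h zero) (∑-cong (h ∘ suc))

∑-0 : ∀ {r} → ∑ {r} (λ _ → 0ℚ) ≡ 0ℚ
∑-0 {zero} = refl
∑-0 {suc r} = trans (cong (0ℚ +_) (∑-0 {r})) (QP.+-identityˡ 0ℚ)

∑-+ : ∀ {r} (f g : Fin r → ℚ) → ∑ (λ i → f i + g i) ≡ ∑ f + ∑ g
∑-+ {zero} f g = refl
∑-+ {suc r} f g =
  trans (cong (f zero + g zero +_) (∑-+ (f ∘ suc) (g ∘ suc)))
        (interchange (f zero) (g zero) (∑ (f ∘ suc)) (∑ (g ∘ suc)))
  where interchange : ∀ a b c d → a + b + (c + d) ≡ a + c + (b + d)
        interchange = solve-∀ ℚ-ring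

∑-*ˡ : ∀ {r} (c : ℚ) (f : Fin r → ℚ) → ∑ (λ i → c * f i) ≡ c * ∑ f
∑-*ˡ {zero} c f = sym (QP.*-zeroʳ c)
∑-*ˡ {suc r} c f = trans (cong (c * f zero +_) (∑-*ˡ c (f ∘ suc)))
                         (sym (QP.*-distribˡ-+ c (f zero) (∑ (f ∘ suc))))

∑-*ʳ : ∀ {r} (c : ℚ) (f : Fin r → ℚ) → ∑ (λ i → f i * c) ≡ ∑ f * c
∑-*ʳ c f = trans (∑-cong (λ i → QP.*-comm (f i) c))
                 (trans (∑-*ˡ c f) (QP.*-comm c (∑ f)))

∑-- : ∀ {r} (f g : Fin r → ℚ) → ∑ (λ i → f i - g i) ≡ ∑ f - ∑ g
∑-- f g = begin
  ∑ (λ i → f i - g i)           ≡⟨ ∑-cong (λ i → cong (f i +_) (neg-as-* (g i))) ⟩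
  ∑ (λ i → f i + (- 1ℚ) * g i)  ≡⟨ ∑-+ f (λ i → (- 1ℚ) * g i) ⟩
  ∑ f + ∑ (λ i → (- 1ℚ) * g i)  ≡⟨ cong (∑ f +_) (trans (∑-*ˡ (- 1ℚ) g) (sym (neg-as-* (∑ g)))) ⟩
  ∑ f - ∑ g                     ∎
  where open ≡-Reasoning
        neg-as-* : ∀ a → - a ≡ (- 1ℚ) * a
        neg-as-* = solve-∀ ℚ-ring

∑-lincomb : ∀ {r} (a b : ℚ) (c c′ f : Fin r → ℚ) →
  ∑ (λ i → (a * c i - b * c′ i) * f i) ≡ a * ∑ (λ i → c i * f i) - b * ∑ (λ i → c′ i * f i)
∑-lincomb a b c c′ f =
  trans (∑-cong (λ i → distrib a b (c i) (c′ i) (f i)))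
    (trans (∑-- (λ i → a * (c i * f i)) (λ i → b * (c′ i * f i)))
      (cong₂ _-_ (∑-*ˡ a (λ i → c i * f i)) (∑-*ˡ b (λ i → c′ i * f i))))
  where distrib : ∀ a b c c′ f → (a * c - b * c′) * f ≡ a * (c * f) - b * (c′ * f)
        distrib = solve-∀ ℚ-ring

∑-swap : ∀ {r s} (F : Fin r → Fin s → ℚ) →
  ∑ (λ i → ∑ (λ j → F i j)) ≡ ∑ (λ j → ∑ (λ i → F i j))
∑-swap {zero} {s} F = sym (∑-0 {s})
∑-swap {suc r} {s} F = trans (cong (∑ (F zero) +_) (∑-swap (F ∘ suc)))
                             (sym (∑-+ (F zero) (λ j → ∑ (λ i → F (suc i) j))))

∑-nonneg : ∀ {r} {f : Fin r → ℚ} → (∀ i → 0ℚ ≤ f i) → 0ℚ ≤ ∑ f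
∑-nonneg {zero} h = QP.≤-refl
∑-nonneg {suc r} h = 0≤+ (h zero) (∑-nonneg (h ∘ suc))

∑-mono : ∀ {r} {f g : Fin r → ℚ} → (∀ i → f i ≤ g i) → ∑ f ≤ ∑ g
∑-mono {zero} h = QP.≤-refl
∑-mono {suc r} h = QP.+-mono-≤ (h zero) (∑-mono (h ∘ suc))

term≤∑ : ∀ {r} {f : Fin r → ℚ} → (∀ i → 0ℚ ≤ f i) → ∀ i → f i ≤ ∑ f
term≤∑ {suc r} {f} h zero =
  subst₂ _≤_ (QP.+-identityʳ (f zero)) refl (QP.+-monoʳ-≤ (f zero) (∑-nonneg (h ∘ suc)))
term≤∑ {suc r} {f} h (suc i) =
  subst₂ _≤_ (QP.+-identityˡ (f (suc i))) refl (QP.+-mono-≤ (h zero) (term≤∑ (h ∘ suc) i))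

∑-nonneg-zero : ∀ {r} {f : Fin r → ℚ} → (∀ i → 0ℚ ≤ f i) → ∑ f ≡ 0ℚ → ∀ i → f i ≡ 0ℚ
∑-nonneg-zero h ∑≡0 i = QP.≤-antisym (subst₂ _≤_ refl ∑≡0 (term≤∑ h i)) (h i)

∑-nonzero : ∀ {r} (f : Fin r → ℚ) → ∑ f ≢ 0ℚ → Σ (Fin r) λ i → f i ≢ 0ℚ
∑-nonzero {zero} f h = ⊥-elim (h refl)
∑-nonzero {suc r} f h with f zero QP.≟ 0ℚ
... | no f0≢0 = zero , f0≢0
... | yes f0≡0 with ∑-nonzero (f ∘ suc) (λ rest≡0 → h (trans (cong₂ _+_ f0≡0 rest≡0) (QP.+-identityˡ 0ℚ)))
...   | i , fi≢0 = suc i , fi≢0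

δ : ∀ {s} → Fin s → Fin s → ℚ
δ zero zero = 1ℚ
δ zero (suc _) = 0ℚ
δ (suc _) zero = 0ℚ
δ (suc a) (suc b) = δ a b

∑-δ : ∀ {s} (l : Fin s) (f : Fin s → ℚ) → ∑ (λ i → δ l i * f i) ≡ f l
∑-δ {suc s} zero f =
  trans (cong₂ _+_ (QP.*-identityˡ (f zero)) (trans (∑-cong (λ i → QP.*-zeroˡ (f (suc i)))) (∑-0 {s})))
        (QP.+-identityʳ (f zero))
∑-δ (suc l) f = trans (cong₂ _+_ (QP.*-zeroˡ (f zero)) (∑-δ l (f ∘ suc))) (QP.+-identityˡ (f (suc l)))

δ-nonneg : ∀ {s} (l i : Fin s) → 0ℚ ≤ δ l i
δ-nonneg zero zero = QP.<⇒≤ 0<1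
δ-nonneg zero (suc i) = QP.≤-refl
δ-nonneg (suc l) zero = QP.≤-refl
δ-nonneg (suc l) (suc i) = δ-nonneg l i

⟪⟫-cong : ∀ {n} {a b c d : Vecℚ n} → (∀ j → a j ≡ b j) → (∀ j → c j ≡ d j) → ⟪ a , c ⟫ ≡ ⟪ b , d ⟫
⟪⟫-cong h₁ h₂ = ∑-cong (λ j → cong₂ _*_ (h₁ j) (h₂ j))

⟪⟫-comm : ∀ {n} (a b : Vecℚ n) → ⟪ a , b ⟫ ≡ ⟪ b , a ⟫
⟪⟫-comm a b = ∑-cong (λ j → QP.*-comm (a j) (b j))

⟪⟫-linear : ∀ {n} (u v w : Vecℚ n) (a b : ℚ) →
  ⟪ u , (λ j → a * v j + b * w j) ⟫ ≡ a * ⟪ u , v ⟫ + b * ⟪ u , w ⟫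
⟪⟫-linear u v w a b =
  trans (∑-cong (λ j → distrib (u j) (v j) (w j) a b))
    (trans (∑-+ (λ j → a * (u j * v j)) (λ j → b * (u j * w j)))
      (cong₂ _+_ (∑-*ˡ a (λ j → u j * v j)) (∑-*ˡ b (λ j → u j * w j))))
  where distrib : ∀ x y z a b → x * (a * y + b * z) ≡ a * (x * y) + b * (x * z)
        distrib = solve-∀ ℚ-ring

⟪⟫-linear⁻ : ∀ {n} (u w v : Vecℚ n) (a b : ℚ) →
  ⟪ (λ j → a * u j - b * w j) , v ⟫ ≡ a * ⟪ u , v ⟫ - b * ⟪ w , v ⟫
⟪⟫-linear⁻ u w v a b =
  trans (∑-cong (λ j → distrib (u j) (w j) (v j) a b))
    (trans (∑-- (λ j → a * (u j * v j)) (λ j → b * (w j * v j)))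
      (cong₂ _-_ (∑-*ˡ a (λ j → u j * v j)) (∑-*ˡ b (λ j → w j * v j))))
  where distrib : ∀ x y z a b → (a * x - b * y) * z ≡ a * (x * z) - b * (y * z)
        distrib = solve-∀ ℚ-ring

⟪⟫-linear⁻ʳ : ∀ {n} (v u w : Vecℚ n) (a b : ℚ) →
  ⟪ v , (λ j → a * u j - b * w j) ⟫ ≡ a * ⟪ v , u ⟫ - b * ⟪ v , w ⟫
⟪⟫-linear⁻ʳ v u w a b = trans (⟪⟫-comm v _)
  (trans (⟪⟫-linear⁻ u w v a b) (cong₂ (λ s t → a * s - b * t) (⟪⟫-comm u v) (⟪⟫-comm w v)))

⟪⟫-scaleʳ : ∀ {n} (u v : Vecℚ n) (a : ℚ) → ⟪ u , (λ j → a * v j) ⟫ ≡ a * ⟪ u , v ⟫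
⟪⟫-scaleʳ u v a = trans (∑-cong (λ j → swap (u j) (v j) a)) (∑-*ˡ a (λ j → u j * v j))
  where swap : ∀ x y a → x * (a * y) ≡ a * (x * y)
        swap = solve-∀ ℚ-ring

⟪⟫-scaleˡ : ∀ {n} (u v : Vecℚ n) (a : ℚ) → ⟪ (λ j → a * u j) , v ⟫ ≡ a * ⟪ u , v ⟫
⟪⟫-scaleˡ u v a = trans (∑-cong (λ j → QP.*-assoc a (u j) (v j))) (∑-*ˡ a (λ j → u j * v j))

⟪⟫-negˡ : ∀ {n} (u v : Vecℚ n) → ⟪ (λ j → - u j) , v ⟫ ≡ - ⟪ u , v ⟫
⟪⟫-negˡ u v = trans (∑-cong (λ j → neg-as-* (u j) (v j)))
                    (trans (∑-*ˡ (- 1ℚ) (λ j → u j * v j)) (sym (neg-as-*′ ⟪ u , v ⟫)))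
  where neg-as-* : ∀ a b → - a * b ≡ (- 1ℚ) * (a * b)
        neg-as-* = solve-∀ ℚ-ring
        neg-as-*′ : ∀ a → - a ≡ (- 1ℚ) * a
        neg-as-*′ = solve-∀ ℚ-ring

⟪⟫-negʳ : ∀ {n} (u v : Vecℚ n) → ⟪ u , (λ j → - v j) ⟫ ≡ - ⟪ u , v ⟫
⟪⟫-negʳ u v = trans (⟪⟫-comm u _) (trans (⟪⟫-negˡ v u) (cong -_ (⟪⟫-comm v u)))

⟪⟫-∑ʳ : ∀ {n r} (u : Vecℚ n) (c : Fin r → ℚ) (W : Fin r → Vecℚ n) →
  ⟪ u , (λ j → ∑ (λ i → c i * W i j)) ⟫ ≡ ∑ (λ i → c i * ⟪ u , W i ⟫)
⟪⟫-∑ʳ u c W =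
  trans (∑-cong (λ j → trans (sym (∑-*ˡ (u j) (λ i → c i * W i j))) (∑-cong (λ i → swap (u j) (c i) (W i j)))))
    (trans (∑-swap (λ j i → c i * (u j * W i j))) (∑-cong (λ i → ∑-*ˡ (c i) (λ j → u j * W i j))))
  where swap : ∀ x y z → x * (y * z) ≡ y * (x * z)
        swap = solve-∀ ℚ-ring

⟪⟫-∑ˡ : ∀ {n r} (u : Vecℚ n) (c : Fin r → ℚ) (W : Fin r → Vecℚ n) →
  ⟪ (λ j → ∑ (λ i → c i * W i j)) , u ⟫ ≡ ∑ (λ i → c i * ⟪ W i , u ⟫)
⟪⟫-∑ˡ u c W = trans (⟪⟫-comm _ u)
  (trans (⟪⟫-∑ʳ u c W) (∑-cong (λ i → cong (c i *_) (⟪⟫-comm u (W i)))))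

⟪⟫-self-nonneg : ∀ {n} (a : Vecℚ n) → 0ℚ ≤ ⟪ a , a ⟫
⟪⟫-self-nonneg a = ∑-nonneg (λ j → 0≤² (a j))

⟪⟫-self-zero : ∀ {n} (a : Vecℚ n) → ⟪ a , a ⟫ ≡ 0ℚ → ∀ j → a j ≡ 0ℚ
⟪⟫-self-zero a h j = ²≡0⇒≡0 (∑-nonneg-zero (λ j → 0≤² (a j)) h j)

-- Farkas' lemma.  It is proved by Fourier–Motzkin elimination: a separator
-- for A_1, …, A_r that fails on A_0 is used to project A_0 away.
InCone : ∀ {d r} → (Fin r → Vecℚ d) → Vecℚ d → Set
InCone {d} {r} A g = Σ (Fin r → ℚ) λ c → (∀ i → 0ℚ ≤ c i) × (∀ j → g j ≡ ∑ (λ i → c i * A i j))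

Separates : ∀ {d r} → (Fin r → Vecℚ d) → Vecℚ d → Set
Separates {d} {r} A g = Σ (Vecℚ d) λ y → (∀ i → 0ℚ ≤ ⟪ y , A i ⟫) × ⟪ y , g ⟫ < 0ℚ

-- The elimination step.  Here y separates g from A_1, …, A_r but a = ⟪y,A_0⟫
-- is negative; A′ and g′ are A_{i+1} and g projected along A_0 onto ker y.
module Elimination {d r} (A : Fin (suc r) → Vecℚ d) (g y : Vecℚ d)
  (y-on-A : ∀ i → 0ℚ ≤ ⟪ y , A (suc i) ⟫) (y-on-g : ⟪ y , g ⟫ < 0ℚ)
  (a<0 : ⟪ y , A zero ⟫ < 0ℚ) where

  a : ℚ
  a = ⟪ y , A zero ⟫

  a≢0 : a ≢ 0ℚ
  a≢0 a≡0 = QP.<-irrefl a≡0 a<0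

  A′ : Fin r → Vecℚ d
  A′ i j = a * A (suc i) j - ⟪ y , A (suc i) ⟫ * A zero j

  g′ : Vecℚ d
  g′ j = a * g j - ⟪ y , g ⟫ * A zero j

  -- If g′ = ∑ μ_i A′_i with μ ≥ 0, then g = κ·A_0 + ∑ μ_i A_{i+1}, where
  -- κ = (⟪y,g⟫ - ∑ μ_i ⟪y,A_{i+1}⟫)/a is a quotient of two negatives.
  lift-cone : InCone A′ g′ → InCone A g
  lift-cone (μ , μ≥0 , g′≡) = c , c≥0 , g≡
    where
    M = ∑ (λ i → μ i * ⟪ y , A (suc i) ⟫)
    a⁻¹ = inv a a≢0
    c : Fin (suc r) → ℚ
    c zero = (⟪ y , g ⟫ - M) * a⁻¹
    c (suc i) = μ i
    numerator<0 : ⟪ y , g ⟫ - M < 0ℚ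
    numerator<0 = QP.<-≤-trans (QP.+-mono-<-≤ y-on-g (QP.neg-antimono-≤ (∑-nonneg (λ i → 0≤* (μ≥0 i) (y-on-A i)))))
                               (QP.≤-reflexive (QP.+-identityʳ 0ℚ))
    c≥0 : ∀ i → 0ℚ ≤ c i
    c≥0 zero = QP.<⇒≤ (<0*<0 numerator<0 (inv-neg a a≢0 a<0))
    c≥0 (suc i) = μ≥0 i
    ∑A′ : ∀ j → ∑ (λ i → μ i * A′ i j) ≡ a * ∑ (λ i → μ i * A (suc i) j) - M * A zero j
    ∑A′ j = trans (∑-cong (λ i → distrib (μ i) (A (suc i) j) ⟪ y , A (suc i) ⟫ a (A zero j)))
      (trans (∑-- (λ i → a * (μ i * A (suc i) j)) (λ i → (μ i * ⟪ y , A (suc i) ⟫) * A zero j))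
        (cong₂ _-_ (∑-*ˡ a (λ i → μ i * A (suc i) j)) (∑-*ʳ (A zero j) (λ i → μ i * ⟪ y , A (suc i) ⟫))))
      where distrib : ∀ m x y a z → m * (a * x - y * z) ≡ a * (m * x) - (m * y) * z
            distrib = solve-∀ ℚ-ring
    solve-for : ∀ G S γ Z → a * G - γ * Z ≡ a * S - M * Z → G ≡ ((γ - M) * a⁻¹) * Z + S
    solve-for G S γ Z h = begin
      G                                        ≡⟨ sym (QP.*-identityʳ G) ⟩
      G * 1ℚ                                   ≡⟨ cong (G *_) (sym (*-inv a a≢0)) ⟩
      G * (a * a⁻¹)                            ≡⟨ expand G a a⁻¹ γ Z ⟩
      (a * G - γ * Z) * a⁻¹ + (γ * Z) * a⁻¹    ≡⟨ cong (λ t → t * a⁻¹ + (γ * Z) * a⁻¹) h ⟩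
      (a * S - M * Z) * a⁻¹ + (γ * Z) * a⁻¹    ≡⟨ regroup a a⁻¹ S M γ Z ⟩
      ((γ - M) * a⁻¹) * Z + S * (a * a⁻¹)      ≡⟨ cong (λ t → ((γ - M) * a⁻¹) * Z + S * t) (*-inv a a≢0) ⟩
      ((γ - M) * a⁻¹) * Z + S * 1ℚ             ≡⟨ cong (((γ - M) * a⁻¹) * Z +_) (QP.*-identityʳ S) ⟩
      ((γ - M) * a⁻¹) * Z + S                  ∎
      where open ≡-Reasoning
            expand : ∀ G a i γ Z → G * (a * i) ≡ (a * G - γ * Z) * i + (γ * Z) * i
            expand = solve-∀ ℚ-ring
            regroup : ∀ a i S M γ Z → (a * S - M * Z) * i + (γ * Z) * i ≡ ((γ - M) * i) * Z + S * (a * i)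
            regroup = solve-∀ ℚ-ring
    g≡ : ∀ j → g j ≡ ∑ (λ i → c i * A i j)
    g≡ j = solve-for (g j) (∑ (λ i → μ i * A (suc i) j)) ⟪ y , g ⟫ (A zero j) (trans (g′≡ j) (∑A′ j))

  -- If y′ separates g′ from the A′_i, then z = a·y′ - ⟪y′,A_0⟫·y separates g
  -- from all A_i: z vanishes on A_0, and z(v) = y′(a·v - ⟪y,v⟫·A_0).
  lift-separator : Separates A′ g′ → Separates A g
  lift-separator (y′ , y′-on-A′ , y′-on-g′) = z , z-on-A , z-on-g
    where
    b = ⟪ y′ , A zero ⟫
    z : Vecℚ d
    z j = a * y′ j - b * y j
    z-pairing : ∀ v → ⟪ z , v ⟫ ≡ ⟪ y′ , (λ j → a * v j - ⟪ y , v ⟫ * A zero j) ⟫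
    z-pairing v = trans (⟪⟫-linear⁻ y′ y v a b)
      (trans (commute a b ⟪ y′ , v ⟫ ⟪ y , v ⟫) (sym (⟪⟫-linear⁻ʳ y′ v (A zero) a ⟪ y , v ⟫)))
      where commute : ∀ a b u w → a * u - b * w ≡ a * u - w * b
            commute = solve-∀ ℚ-ring
    z-on-A : ∀ i → 0ℚ ≤ ⟪ z , A i ⟫
    z-on-A zero = QP.≤-reflexive (sym (trans (⟪⟫-linear⁻ y′ y (A zero) a b) (cancel a b)))
      where cancel : ∀ a b → a * b - b * a ≡ 0ℚ
            cancel = solve-∀ ℚ-ring
    z-on-A (suc i) = subst (0ℚ ≤_) (sym (z-pairing (A (suc i)))) (y′-on-A′ i)
    z-on-g : ⟪ z , g ⟫ < 0ℚ
    z-on-g = subst (_< 0ℚ) (sym (z-pairing g)) y′-on-g′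

-- The base case r = 0 separates g ≠ 0 by -g; the inductive step either
-- extends a representation by c₀ = 0, reuses a separator that is already
-- ≥ 0 on A_0, or eliminates A_0.
farkas : ∀ {d} r (A : Fin r → Vecℚ d) (g : Vecℚ d) → InCone A g ⊎ Separates A g
farkas zero A g with ⟪ g , g ⟫ QP.≟ 0ℚ
... | yes gg≡0 = inj₁ ((λ ()) , (λ ()) , ⟪⟫-self-zero g gg≡0)
... | no gg≢0 = inj₂ ((λ j → - g j) , (λ ()) ,
        subst (_< 0ℚ) (sym (⟪⟫-negˡ g g)) (QP.neg-antimono-< (0≤∧≢0⇒0< (⟪⟫-self-nonneg g) gg≢0)))
farkas (suc r) A g with farkas r (A ∘ suc) g
... | inj₁ (c , c≥0 , g≡) = inj₁ (c′ , c′≥0 , g≡′)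
  where
  c′ : Fin (suc r) → ℚ
  c′ zero = 0ℚ
  c′ (suc i) = c i
  c′≥0 : ∀ i → 0ℚ ≤ c′ i
  c′≥0 zero = QP.≤-refl
  c′≥0 (suc i) = c≥0 i
  g≡′ : ∀ j → g j ≡ ∑ (λ i → c′ i * A i j)
  g≡′ j = trans (g≡ j) (sym (trans (cong (_+ ∑ (λ i → c i * A (suc i) j)) (QP.*-zeroˡ (A zero j)))
                                   (QP.+-identityˡ _)))
... | inj₂ (y , y-on-A , y-on-g) with 0ℚ QP.≤? ⟪ y , A zero ⟫
...   | yes y-on-A₀ = inj₂ (y , y-on-all , y-on-g)
  where y-on-all : ∀ i → 0ℚ ≤ ⟪ y , A i ⟫
        y-on-all zero = y-on-A₀
        y-on-all (suc i) = y-on-A i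
...   | no y-neg-on-A₀ = Sum.map E.lift-cone E.lift-separator (farkas r E.A′ E.g′)
  where module E = Elimination A g y y-on-A y-on-g (QP.≰⇒> y-neg-on-A₀)

-- The embedding ℤ → ℚ is an ordered ring homomorphism; it is checked on
-- unnormalised rationals, where z/1 is represented literally.
private
  toℚᵘ-ℤ→ℚ : ∀ z → Q.toℚᵘ (ℤ→ℚ z) U.≃ U.mkℚᵘ z 0
  toℚᵘ-ℤ→ℚ z = QP.toℚᵘ-fromℚᵘ (U.mkℚᵘ z 0)

ℤ→ℚ-+ : ∀ a b → ℤ→ℚ (a Z.+ b) ≡ ℤ→ℚ a + ℤ→ℚ b
ℤ→ℚ-+ a b = QP.toℚᵘ-injective (UP.≃-trans (toℚᵘ-ℤ→ℚ (a Z.+ b)) (UP.≃-trans (U.*≡* (identity a b))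
  (UP.≃-sym (UP.≃-trans (QP.toℚᵘ-homo-+ (ℤ→ℚ a) (ℤ→ℚ b)) (UP.+-cong (toℚᵘ-ℤ→ℚ a) (toℚᵘ-ℤ→ℚ b))))))
  where identity : ∀ a b → (a Z.+ b) Z.* Z.+ 1 ≡ (a Z.* Z.+ 1 Z.+ b Z.* Z.+ 1) Z.* Z.+ 1
        identity = ZS.solve-∀

ℤ→ℚ-* : ∀ a b → ℤ→ℚ (a Z.* b) ≡ ℤ→ℚ a * ℤ→ℚ b
ℤ→ℚ-* a b = QP.toℚᵘ-injective (UP.≃-trans (toℚᵘ-ℤ→ℚ (a Z.* b))
  (UP.≃-sym (UP.≃-trans (QP.toℚᵘ-homo-* (ℤ→ℚ a) (ℤ→ℚ b)) (UP.*-cong (toℚᵘ-ℤ→ℚ a) (toℚᵘ-ℤ→ℚ b)))))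

ℤ→ℚ-- : ∀ a b → ℤ→ℚ (a Z.- b) ≡ ℤ→ℚ a - ℤ→ℚ b
ℤ→ℚ-- a b = trans (ℤ→ℚ-+ a (Z.- b)) (cong (ℤ→ℚ a +_) neg)
  where neg : ℤ→ℚ (Z.- b) ≡ - ℤ→ℚ b
        neg = QP.toℚᵘ-injective (UP.≃-trans (toℚᵘ-ℤ→ℚ (Z.- b))
          (UP.≃-sym (UP.≃-trans (QP.toℚᵘ-homo‿- (ℤ→ℚ b)) (UP.-‿cong (toℚᵘ-ℤ→ℚ b)))))

ℤ→ℚ-mono-≤ : ∀ {a b} → a Z.≤ b → ℤ→ℚ a ≤ ℤ→ℚ b
ℤ→ℚ-mono-≤ {a} {b} h = QP.toℚᵘ-cancel-≤ (UP.≤-respʳ-≃ (UP.≃-sym (toℚᵘ-ℤ→ℚ b))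
  (UP.≤-respˡ-≃ (UP.≃-sym (toℚᵘ-ℤ→ℚ a)) (U.*≤* (ZP.*-monoʳ-≤-nonNeg (Z.+ 1) h))))

integer-≤0⊎≥1 : ∀ z → ℤ→ℚ z ≤ 0ℚ ⊎ 1ℚ ≤ ℤ→ℚ z
integer-≤0⊎≥1 (Z.+ zero) = inj₁ QP.≤-refl
integer-≤0⊎≥1 Z.+[1+ n ] = inj₂ (ℤ→ℚ-mono-≤ {Z.1ℤ} {Z.+[1+ n ]} (Z.+≤+ (ℕ.s≤s ℕ.z≤n)))
integer-≤0⊎≥1 Z.-[1+ n ] = inj₁ (ℤ→ℚ-mono-≤ {Z.-[1+ n ]} {Z.0ℤ} Z.-≤+)

*-/-cancel : ∀ k (m : ℤ) → ℤ→ℚ (Z.+ suc k) * (m / suc k) ≡ ℤ→ℚ m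
*-/-cancel k m = QP.toℚᵘ-injective (UP.≃-trans (QP.toℚᵘ-homo-* (ℤ→ℚ (Z.+ suc k)) (m / suc k))
  (UP.≃-trans (UP.*-cong (toℚᵘ-ℤ→ℚ (Z.+ suc k)) (QP.toℚᵘ-fromℚᵘ (U.mkℚᵘ m k)))
  (UP.≃-trans (U.*≡* (identity (Z.+ suc k) m)) (UP.≃-sym (toℚᵘ-ℤ→ℚ m)))))
  where identity : ∀ K m → (K Z.* m) Z.* Z.+ 1 ≡ m Z.* (Z.+ 1 Z.* K)
        identity = ZS.solve-∀

0<suc : ∀ k → 0ℚ < ℤ→ℚ (Z.+ suc k)
0<suc k = QP.toℚᵘ-cancel-< (UP.<-respʳ-≃ (UP.≃-sym (toℚᵘ-ℤ→ℚ (Z.+ suc k))) (U.*<* (Z.+<+ (ℕ.s≤s ℕ.z≤n))))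

-- Homogenisation.  `snoc a c` appends the coordinate c; its first n
-- coordinates are `inject₁ j` and the new one is `fromℕ n`.
snoc-inject₁ : ∀ {n} (a : Vecℚ n) c j → snoc a c (inject₁ j) ≡ a j
snoc-inject₁ {suc n} a c zero = refl
snoc-inject₁ {suc n} a c (suc j) = snoc-inject₁ (a ∘ suc) c j

snoc-last : ∀ {n} (a : Vecℚ n) c → snoc a c (fromℕ n) ≡ c
snoc-last {zero} a c = refl
snoc-last {suc n} a c = snoc-last (a ∘ suc) c

snoc-ext : ∀ {n} (x y : Vecℚ (suc n)) → (∀ j → x (inject₁ j) ≡ y (inject₁ j)) →
  x (fromℕ n) ≡ y (fromℕ n) → ∀ j → x j ≡ y j
snoc-ext {zero} x y init last zero = last
snoc-ext {suc n} x y init last zero = init zero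
snoc-ext {suc n} x y init last (suc j) = snoc-ext (x ∘ suc) (y ∘ suc) (init ∘ suc) last j

snoc-cong : ∀ {n} {a b : Vecℚ n} {c d} → (∀ j → a j ≡ b j) → c ≡ d → ∀ j → snoc a c j ≡ snoc b d j
snoc-cong {zero} a≡b c≡d zero = c≡d
snoc-cong {suc n} a≡b c≡d zero = a≡b zero
snoc-cong {suc n} a≡b c≡d (suc j) = snoc-cong (a≡b ∘ suc) c≡d j

snoc-∑ : ∀ {n r} (c : Fin r → ℚ) (v : Fin r → Vecℚ n) (h : Fin r → ℚ) j →
  ∑ (λ i → c i * snoc (v i) (h i) j) ≡ snoc (λ j′ → ∑ (λ i → c i * v i j′)) (∑ (λ i → c i * h i)) j
snoc-∑ {zero} c v h zero = refl
snoc-∑ {suc n} c v h zero = refl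
snoc-∑ {suc n} c v h (suc j) = snoc-∑ c (λ i → v i ∘ suc) h j

α-∑ : ∀ {n r} (c : Fin r → ℚ) (v : Fin r → Vecℚ n) → ∑ c ≡ 1ℚ →
  ∀ j → α (λ j′ → ∑ (λ i → c i * v i j′)) j ≡ ∑ (λ i → c i * α (v i) j)
α-∑ c v ∑c≡1 j = sym (trans (snoc-∑ c v (λ _ → 1ℚ) j)
  (snoc-cong (λ _ → refl) (trans (∑-cong (λ i → QP.*-identityʳ (c i))) ∑c≡1) j))

scaled-α-init : ∀ {n} {x : Vecℚ (suc n)} {t a} → (∀ j → x j ≡ t * α a j) → ∀ j → x (inject₁ j) ≡ t * a j
scaled-α-init {t = t} {a} x≡ j = trans (x≡ (inject₁ j)) (cong (t *_) (snoc-inject₁ a 1ℚ j))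

scaled-α-last : ∀ {n} {x : Vecℚ (suc n)} {t a} → (∀ j → x j ≡ t * α a j) → x (fromℕ n) ≡ t
scaled-α-last {n} {t = t} {a} x≡ = trans (x≡ (fromℕ n)) (trans (cong (t *_) (snoc-last a 1ℚ)) (QP.*-identityʳ t))

shift-coordinates : ∀ {n} {x : Vecℚ (suc n)} {p : Vecℚ n} {l t T a aₓ} →
  (∀ j → x j ≡ T * α aₓ j) → (∀ j → shiftDown x l p j ≡ t * α a j) →
  (∀ j → t * a j ≡ T * aₓ j - l * p j) × (t ≡ T - l)
shift-coordinates {p = p} {l} {t} {T} {a} {aₓ} x≡ Y≡ = init , last
  where
  init : ∀ j → t * a j ≡ T * aₓ j - l * p j
  init j = trans (sym (scaled-α-init {t = t} {a} Y≡ j))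
    (cong₂ (λ s s′ → s - l * s′) (scaled-α-init {t = T} {aₓ} x≡ j) (snoc-inject₁ p 1ℚ j))
  last : t ≡ T - l
  last = trans (sym (scaled-α-last {t = t} {a} Y≡))
    (trans (cong₂ (λ s s′ → s - l * s′) (scaled-α-last {t = T} {aₓ} x≡) (snoc-last p 1ℚ))
           (cong (λ s → T - s) (QP.*-identityʳ l)))

⟪⟫-α : ∀ {n} (ψ : Vecℚ (suc n)) (a : Vecℚ n) →
  ⟪ ψ , α a ⟫ ≡ ⟪ (λ j → ψ (inject₁ j)) , a ⟫ + ψ (fromℕ n)
⟪⟫-α {zero} ψ a = trans (QP.+-identityʳ (ψ zero * 1ℚ)) (trans (QP.*-identityʳ (ψ zero)) (sym (QP.+-identityˡ (ψ zero))))
⟪⟫-α {suc n} ψ a = trans (cong (ψ zero * a zero +_) (⟪⟫-α (ψ ∘ suc) (a ∘ suc)))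
  (sym (QP.+-assoc (ψ zero * a zero) ⟪ (λ j → ψ (suc (inject₁ j))) , a ∘ suc ⟫ (ψ (fromℕ (suc n)))))

snocℤ : ∀ {n} → Vecℤ n → ℤ → Vecℤ (suc n)
snocℤ {zero} a c zero = c
snocℤ {suc n} a c zero = a zero
snocℤ {suc n} a c (suc i) = snocℤ (a ∘ suc) c i

ι-snocℤ : ∀ {n} (a : Vecℤ n) c j → ι (snocℤ a c) j ≡ snoc (ι a) (ℤ→ℚ c) j
ι-snocℤ {zero} a c zero = refl
ι-snocℤ {suc n} a c zero = refl
ι-snocℤ {suc n} a c (suc j) = ι-snocℤ (a ∘ suc) c j

-∣∣≤∧≤∣∣ : ∀ x → (- ∣ x ∣ ≤ x) × (x ≤ ∣ x ∣)
-∣∣≤∧≤∣∣ x with QP.∣p∣≡p∨∣p∣≡-p x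
... | inj₁ ∣x∣≡x = QP.≤-trans (QP.neg-antimono-≤ (QP.0≤∣p∣ x)) (subst (0ℚ ≤_) ∣x∣≡x (QP.0≤∣p∣ x)) ,
                  QP.≤-reflexive (sym ∣x∣≡x)
... | inj₂ ∣x∣≡-x = QP.≤-reflexive (trans (cong -_ ∣x∣≡-x) (neg-neg x)) ,
                   QP.≤-trans (0≤-⇒≤0 (subst (0ℚ ≤_) ∣x∣≡-x (QP.0≤∣p∣ x))) (QP.0≤∣p∣ x)
  where neg-neg : ∀ a → - - a ≡ a
        neg-neg = solve-∀ ℚ-ring

-- For δ > 0 and S ≥ 0 some ε > 0 has ε·S < δ, namely ε = δ/(1+S).
small-factor : ∀ {δ S} → 0ℚ < δ → 0ℚ ≤ S → Σ ℚ λ ε → 0ℚ < ε × ε * S < δ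
small-factor {δ} {S} 0<δ 0≤S = ε , 0<ε , 0<-⇒< (subst (0ℚ <_) (sym δ-εS≡ε) 0<ε)
  where
  0<1+S = 0<+ 0<1 0≤S
  1+S≢0 = 0<⇒≢0 0<1+S
  ε = δ * inv (1ℚ + S) 1+S≢0
  0<ε : 0ℚ < ε
  0<ε = 0<* 0<δ (inv-pos (1ℚ + S) 1+S≢0 0<1+S)
  δ-εS≡ε : δ - ε * S ≡ ε
  δ-εS≡ε = begin
    δ - ε * S                                  ≡⟨ cong (λ t → t - ε * S) (sym (QP.*-identityʳ δ)) ⟩
    δ * 1ℚ - ε * S                             ≡⟨ cong (λ t → δ * t - ε * S) (sym (*-inv (1ℚ + S) 1+S≢0)) ⟩
    δ * ((1ℚ + S) * inv (1ℚ + S) 1+S≢0) - ε * S ≡⟨ regroup δ S (inv (1ℚ + S) 1+S≢0) ⟩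
    ε                                          ∎
    where open ≡-Reasoning
          regroup : ∀ d S i → d * ((1ℚ + S) * i) - d * i * S ≡ d * i
          regroup = solve-∀ ℚ-ring

small-multiple : ∀ {δ S w ε} → 0ℚ ≤ ε → ∣ w ∣ ≤ S → ε * S < δ → (- δ < ε * w) × (ε * w < δ)
small-multiple {δ} {S} {w} {ε} 0≤ε ∣w∣≤S εS<δ = lower , upper
  where
  instance _ = Q.nonNegative 0≤ε
  upper : ε * w < δ
  upper = QP.≤-<-trans (QP.*-monoˡ-≤-nonNeg ε (QP.≤-trans (proj₂ (-∣∣≤∧≤∣∣ w)) ∣w∣≤S)) εS<δ
  lower : - δ < ε * w
  lower = QP.<-≤-trans (subst (- δ <_) (QP.neg-distribʳ-* ε S) (QP.neg-antimono-< εS<δ))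
                       (QP.*-monoˡ-≤-nonNeg ε (QP.≤-trans (QP.neg-antimono-≤ ∣w∣≤S) (proj₁ (-∣∣≤∧≤∣∣ w))))

⟪⟫-conv : ∀ {n r} {W : Fin r → Vecℚ n} (ψ : Vecℚ n) {x} (cx : Conv W x) →
  ⟪ ψ , x ⟫ ≡ ∑ (λ i → proj₁ cx i * ⟪ ψ , W i ⟫)
⟪⟫-conv {W = W} ψ (c , _ , _ , x≡) = trans (⟪⟫-cong {a = ψ} (λ _ → refl) x≡) (⟪⟫-∑ʳ ψ c W)

conv-bound : ∀ {n r} {W : Fin r → Vecℚ n} (ψ : Vecℚ n) → (∀ i → ⟪ ψ , W i ⟫ ≤ 1ℚ) →
  ∀ x → Conv W x → ⟪ ψ , x ⟫ ≤ 1ℚ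
conv-bound ψ ψ≤1 x cx@(c , c≥0 , ∑c≡1 , _) =
  subst₂ _≤_ (sym (⟪⟫-conv ψ cx)) (trans (∑-cong (λ i → QP.*-identityʳ (c i))) ∑c≡1)
    (∑-mono (λ i → QP.*-monoˡ-≤-nonNeg (c i) {{Q.nonNegative (c≥0 i)}} (ψ≤1 i)))

conv⊆lin : ∀ {n r} {W : Fin r → Vecℚ n} {x} → Conv W x → Lin W x
conv⊆lin (c , _ , _ , x≡) = c , x≡

lin-cong : ∀ {n r} {W : Fin r → Vecℚ n} {x y} → (∀ j → x j ≡ y j) → Lin W y → Lin W x
lin-cong x≡y (c , y≡) = c , λ j → trans (x≡y j) (y≡ j)

vertex∈conv : ∀ {n r} (W : Fin r → Vecℚ n) l → Conv W (W l)
vertex∈conv W l = δ l , δ-nonneg l , ∑δ≡1 , λ j → sym (∑-δ l (λ i → W i j))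
  where ∑δ≡1 = trans (∑-cong (λ i → sym (QP.*-identityʳ (δ l i)))) (∑-δ l (λ _ → 1ℚ))

-- A weighted average of values ≤ 1 that equals 1 attains 1 at some weight
-- that is nonzero: ∑ d_l (1 - u_l) = 0 forces d_l (1 - u_l) = 0 for all l.
average-attains : ∀ {s} (d u : Fin s → ℚ) → (∀ l → 0ℚ ≤ d l) → ∑ d ≡ 1ℚ →
  (∀ l → u l ≤ 1ℚ) → ∑ (λ l → d l * u l) ≡ 1ℚ → Σ (Fin s) λ l → u l ≡ 1ℚ
average-attains d u d≥0 ∑d≡1 u≤1 ∑du≡1 with ∑-nonzero d (λ ∑d≡0 → 0<⇒≢0 0<1 (trans (sym ∑d≡1) ∑d≡0))
... | l , dl≢0 = l , sym (-0≡0⇒≡ gap≡0)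
  where
  gap≡0 : 1ℚ - u l ≡ 0ℚ
  gap≡0 = *≡0⇒≡0 dl≢0 (∑-nonneg-zero (λ l → 0≤* (d≥0 l) (≤⇒0≤- (u≤1 l))) ∑gaps≡0 l)
    where
    ∑gaps≡0 : ∑ (λ l → d l * (1ℚ - u l)) ≡ 0ℚ
    ∑gaps≡0 = begin
      ∑ (λ l → d l * (1ℚ - u l))        ≡⟨ ∑-cong (λ l → distrib (d l) (u l)) ⟩
      ∑ (λ l → d l - d l * u l)         ≡⟨ ∑-- d (λ l → d l * u l) ⟩
      ∑ d - ∑ (λ l → d l * u l)         ≡⟨ cong₂ _-_ ∑d≡1 ∑du≡1 ⟩
      1ℚ - 1ℚ                           ≡⟨ QP.+-inverseʳ 1ℚ ⟩
      0ℚ                                ∎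
      where open ≡-Reasoning
            distrib : ∀ a b → a * (1ℚ - b) ≡ a - a * b
            distrib = solve-∀ ℚ-ring

tight-vertex : ∀ {n r} {W : Fin r → Vecℚ n} (φ : Vecℚ n) → (∀ i → ⟪ φ , W i ⟫ ≤ 1ℚ) →
  ∀ {x} → Conv W x → ⟪ φ , x ⟫ ≡ 1ℚ → Σ (Fin r) λ i → ⟪ φ , W i ⟫ ≡ 1ℚ
tight-vertex φ φ≤1 cx@(c , c≥0 , ∑c≡1 , _) φx≡1 =
  average-attains c (λ i → ⟪ φ , _ ⟫) c≥0 ∑c≡1 φ≤1 (trans (sym (⟪⟫-conv φ cx)) φx≡1)

conv-scale : ∀ {n r} (K : ℚ) {W W″ : Fin r → Vecℚ n} → (∀ i j → W″ i j ≡ K * W i j) →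
  ∀ {a} → Conv W a → Conv W″ (λ j → K * a j)
conv-scale K {W} {W″} W″≡ (c , c≥0 , ∑c≡1 , a≡) = c , c≥0 , ∑c≡1 , λ j → sym (begin
  ∑ (λ i → c i * W″ i j)        ≡⟨ ∑-cong (λ i → trans (cong (c i *_) (W″≡ i j)) (swap (c i) K (W i j))) ⟩
  ∑ (λ i → K * (c i * W i j))   ≡⟨ ∑-*ˡ K (λ i → c i * W i j) ⟩
  K * ∑ (λ i → c i * W i j)     ≡⟨ cong (K *_) (sym (a≡ j)) ⟩
  K * _                         ∎)
  where open ≡-Reasoning
        swap : ∀ c K w → c * (K * w) ≡ K * (c * w)
        swap = solve-∀ ℚ-ring

module Translation {n r} (W W′ : Fin r → Vecℚ n) (t : Vecℚ n)
  (W′≡ : ∀ i j → W′ i j ≡ W i j - t j) where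

  affine-shift : (c : Fin r → ℚ) → ∑ c ≡ 1ℚ →
    ∀ j → ∑ (λ i → c i * W′ i j) ≡ ∑ (λ i → c i * W i j) - t j
  affine-shift c ∑c≡1 j = begin
    ∑ (λ i → c i * W′ i j)
      ≡⟨ ∑-cong (λ i → trans (cong (c i *_) (W′≡ i j)) (distrib (c i) (W i j) (t j))) ⟩
    ∑ (λ i → c i * W i j - c i * t j)
      ≡⟨ ∑-- (λ i → c i * W i j) (λ i → c i * t j) ⟩
    ∑ (λ i → c i * W i j) - ∑ (λ i → c i * t j)
      ≡⟨ cong (λ s → ∑ (λ i → c i * W i j) - s) (trans (∑-*ʳ (t j) c) (cong (_* t j) ∑c≡1)) ⟩
    ∑ (λ i → c i * W i j) - 1ℚ * t j
      ≡⟨ cong (λ s → ∑ (λ i → c i * W i j) - s) (QP.*-identityˡ (t j)) ⟩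
    ∑ (λ i → c i * W i j) - t j ∎
    where open ≡-Reasoning
          distrib : ∀ a b c → a * (b - c) ≡ a * b - a * c
          distrib = solve-∀ ℚ-ring

  conv-translate : ∀ {y z} → (∀ j → z j ≡ y j - t j) → Conv W y → Conv W′ z
  conv-translate z≡ (c , c≥0 , ∑c≡1 , y≡) = c , c≥0 , ∑c≡1 ,
    λ j → trans (z≡ j) (trans (cong (_- t j) (y≡ j)) (sym (affine-shift c ∑c≡1 j)))

  conv-untranslate : ∀ {y z} → (∀ j → z j ≡ y j - t j) → Conv W′ z → Conv W y
  conv-untranslate {y} {z} z≡ (c , c≥0 , ∑c≡1 , z≡′) = c , c≥0 , ∑c≡1 ,
    λ j → -‿cancelʳ (trans (sym (z≡ j)) (trans (z≡′ j) (affine-shift c ∑c≡1 j)))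

  lin-difference : ∀ {y y′} → Conv W y → Conv W y′ → (s : ℚ) → Lin W′ (λ j → s * (y j - y′ j))
  lin-difference {y} {y′} (c , _ , ∑c≡1 , y≡) (c′ , _ , ∑c′≡1 , y′≡) s =
    (λ i → s * c i - s * c′ i) , λ j → sym (begin
      ∑ (λ i → (s * c i - s * c′ i) * W′ i j)
        ≡⟨ ∑-lincomb s s c c′ (λ i → W′ i j) ⟩
      s * ∑ (λ i → c i * W′ i j) - s * ∑ (λ i → c′ i * W′ i j)
        ≡⟨ cong₂ (λ u u′ → s * u - s * u′) (affine-shift c ∑c≡1 j) (affine-shift c′ ∑c′≡1 j) ⟩
      s * (∑ (λ i → c i * W i j) - t j) - s * (∑ (λ i → c′ i * W i j) - t j)
        ≡⟨ cong₂ (λ u u′ → s * (u - t j) - s * (u′ - t j)) (sym (y≡ j)) (sym (y′≡ j)) ⟩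
      s * (y j - t j) - s * (y′ j - t j)
        ≡⟨ cancel s (y j) (y′ j) (t j) ⟩
      s * (y j - y′ j) ∎)
    where open ≡-Reasoning
          cancel : ∀ s y y′ t → s * (y - t) - s * (y′ - t) ≡ s * (y - y′)
          cancel = solve-∀ ℚ-ring

relint-stretch : ∀ {n r} {W : Fin r → Vecℚ n} {x z} → RelInt W x → Conv W z →
  Σ ℚ λ ε → 0ℚ < ε × Conv W (λ j → x j + ε * (x j - z j))
relint-stretch {n} {r} {W} {x} {z} ((cx , _ , ∑cx≡1 , x≡) , δ , 0<δ , ball) (cz , _ , ∑cz≡1 , z≡) =
  ε , 0<ε , ball y y-aff y-near
  where
  factor = small-factor 0<δ (∑-nonneg (λ j → QP.0≤∣p∣ (x j - z j)))
  ε = proj₁ factor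
  0<ε = proj₁ (proj₂ factor)
  εS<δ = proj₂ (proj₂ factor)
  y : Vecℚ n
  y j = x j + ε * (x j - z j)
  -- y = (1+ε)·x - ε·z is an affine combination of the vertices
  d : Fin r → ℚ
  d i = (1ℚ + ε) * cx i - ε * cz i
  ∑d≡1 : ∑ d ≡ 1ℚ
  ∑d≡1 = begin
    ∑ d                                        ≡⟨ ∑-- (λ i → (1ℚ + ε) * cx i) (λ i → ε * cz i) ⟩
    ∑ (λ i → (1ℚ + ε) * cx i) - ∑ (λ i → ε * cz i) ≡⟨ cong₂ _-_ (∑-*ˡ (1ℚ + ε) cx) (∑-*ˡ ε cz) ⟩
    (1ℚ + ε) * ∑ cx - ε * ∑ cz                 ≡⟨ cong₂ (λ u u′ → (1ℚ + ε) * u - ε * u′) ∑cx≡1 ∑cz≡1 ⟩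
    (1ℚ + ε) * 1ℚ - ε * 1ℚ                     ≡⟨ cancel ε ⟩
    1ℚ                                         ∎
    where open ≡-Reasoning
          cancel : ∀ e → (1ℚ + e) * 1ℚ - e * 1ℚ ≡ 1ℚ
          cancel = solve-∀ ℚ-ring
  y≡ : ∀ j → y j ≡ ∑ (λ i → d i * W i j)
  y≡ j = sym (begin
    ∑ (λ i → d i * W i j)
      ≡⟨ ∑-lincomb (1ℚ + ε) ε cx cz (λ i → W i j) ⟩
    (1ℚ + ε) * ∑ (λ i → cx i * W i j) - ε * ∑ (λ i → cz i * W i j)
      ≡⟨ cong₂ (λ u u′ → (1ℚ + ε) * u - ε * u′) (sym (x≡ j)) (sym (z≡ j)) ⟩
    (1ℚ + ε) * x j - ε * z j
      ≡⟨ regroup ε (x j) (z j) ⟩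
    y j ∎)
    where open ≡-Reasoning
          regroup : ∀ e x z → (1ℚ + e) * x - e * z ≡ x + e * (x - z)
          regroup = solve-∀ ℚ-ring
  y-aff : Aff W y
  y-aff = d , ∑d≡1 , y≡
  y-near : ∀ j → (- δ < y j - x j) × (y j - x j < δ)
  y-near j = subst (λ s → (- δ < s) × (s < δ)) (sym (step (x j) (ε * (x j - z j))))
    (small-multiple (QP.<⇒≤ 0<ε) (term≤∑ (λ j → QP.0≤∣p∣ (x j - z j)) j) εS<δ)
    where step : ∀ a b → (a + b) - a ≡ b
          step = solve-∀ ℚ-ring

cone-cong : ∀ {n r} {v : Fin r → Vecℚ n} {w w′ : Vecℚ (suc n)} →
  (∀ j → w j ≡ w′ j) → ConeOf v w′ → ConeOf v w
cone-cong w≡w′ (t , a , 0≤t , a∈P , w′≡) = t , a , 0≤t , a∈P , λ j → trans (w≡w′ j) (w′≡ j)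

-- A nonnegative combination w = ∑ e_i α(v_i) lies in cone(conv v): it is
-- T·α(a) for T = ∑ e_i and a = ∑ (e_i/T) v_i (any a if T = 0).
cone-combination : ∀ {n r} (v : Fin r → Vecℚ n) {a₀} → Conv v a₀ →
  (e : Fin r → ℚ) → (∀ i → 0ℚ ≤ e i) →
  ∀ {w} → (∀ j → w j ≡ ∑ (λ i → e i * α (v i) j)) → ConeOf v w
cone-combination {n} {r} v {a₀} a₀∈P e e≥0 {w} w≡ = by-cases (∑ e QP.≟ 0ℚ)
  where
  by-cases : Dec (∑ e ≡ 0ℚ) → ConeOf v w
  by-cases (yes ∑e≡0) = 0ℚ , a₀ , QP.≤-refl , a₀∈P , λ j → begin
    w j                            ≡⟨ w≡ j ⟩
    ∑ (λ i → e i * α (v i) j)      ≡⟨ ∑-cong (λ i → trans (cong (_* α (v i) j) (∑-nonneg-zero e≥0 ∑e≡0 i))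
                                                           (QP.*-zeroˡ (α (v i) j))) ⟩
    ∑ {r} (λ _ → 0ℚ)               ≡⟨ ∑-0 {r} ⟩
    0ℚ                             ≡⟨ sym (QP.*-zeroˡ (α a₀ j)) ⟩
    0ℚ * α a₀ j                    ∎
    where open ≡-Reasoning
  by-cases (no ∑e≢0) = T , a , QP.<⇒≤ 0<T , (c , c≥0 , ∑c≡1 , λ j → refl) , w≡Tαa
    where
    T = ∑ e
    0<T = 0≤∧≢0⇒0< (∑-nonneg e≥0) ∑e≢0
    T⁻¹ = inv T ∑e≢0
    c : Fin r → ℚ
    c i = e i * T⁻¹
    c≥0 : ∀ i → 0ℚ ≤ c i
    c≥0 i = 0≤* (e≥0 i) (QP.<⇒≤ (inv-pos T ∑e≢0 0<T))
    ∑c≡1 : ∑ c ≡ 1ℚ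
    ∑c≡1 = trans (∑-*ʳ T⁻¹ e) (*-inv T ∑e≢0)
    a : Vecℚ n
    a j = ∑ (λ i → c i * v i j)
    w≡Tαa : ∀ j → w j ≡ T * α a j
    w≡Tαa j = begin
      w j                                  ≡⟨ w≡ j ⟩
      ∑ (λ i → e i * α (v i) j)            ≡⟨ ∑-cong (λ i → rescale T T⁻¹ (e i) (α (v i) j) (*-inv T ∑e≢0)) ⟩
      ∑ (λ i → T * (c i * α (v i) j))      ≡⟨ ∑-*ˡ T (λ i → c i * α (v i) j) ⟩
      T * ∑ (λ i → c i * α (v i) j)        ≡⟨ cong (T *_) (sym (α-∑ c v ∑c≡1 j)) ⟩
      T * α a j                            ∎
      where open ≡-Reasoning
            rescale : ∀ T T⁻¹ e x → T * T⁻¹ ≡ 1ℚ → e * x ≡ T * ((e * T⁻¹) * x)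
            rescale T T⁻¹ e x h = trans (sym (QP.*-identityˡ (e * x)))
              (trans (cong (_* (e * x)) (sym h)) (regroup T T⁻¹ e x))
              where regroup : ∀ T T⁻¹ e x → (T * T⁻¹) * (e * x) ≡ T * ((e * T⁻¹) * x)
                    regroup = solve-∀ ℚ-ring

-- Reflexive polytopes.  `DualDescription Q` is the second half of
-- `IsReflexive`: dual-lattice points Φ_1, …, Φ_s whose convex hull is Q^∨,
-- functionals being compared by their restrictions to lin Q.
DualDescription : ∀ {n r} → (Fin r → Vecℚ n) → Set
DualDescription {n} {r} Q =
  Σ ℕ λ s → Σ (Fin s → Vecℚ n) λ Φ →
    (∀ l → InDualLattice Q (Φ l)) ×
    (∀ (ψ : Vecℚ n) →
      ((∀ x → Conv Q x → ⟪ ψ , x ⟫ ≤ 1ℚ) →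
         Σ (Vecℚ n) λ φ → Conv Φ φ × (∀ x → Lin Q x → ⟪ ψ , x ⟫ ≡ ⟪ φ , x ⟫))
      × ((Σ (Vecℚ n) λ φ → Conv Φ φ × (∀ x → Lin Q x → ⟪ ψ , x ⟫ ≡ ⟪ φ , x ⟫)) →
         (∀ x → Conv Q x → ⟪ ψ , x ⟫ ≤ 1ℚ)))

module Reflexive {n r} (Q : Fin r → Vecℚ n) (R : DualDescription Q) where

  #Φ : ℕ
  #Φ = proj₁ R

  Φ : Fin #Φ → Vecℚ n
  Φ = proj₁ (proj₂ R)

  Φ-integral : ∀ l → InDualLattice Q (Φ l)
  Φ-integral = proj₁ (proj₂ (proj₂ R))

  Φ≤1 : ∀ l x → Conv Q x → ⟪ Φ l , x ⟫ ≤ 1ℚ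
  Φ≤1 l = proj₂ (proj₂ (proj₂ (proj₂ R)) (Φ l)) (Φ l , vertex∈conv Φ l , λ _ _ → refl)

  represent : (ψ : Vecℚ n) → (∀ i → ⟪ ψ , Q i ⟫ ≤ 1ℚ) →
    Σ (Fin #Φ → ℚ) λ d → (∀ l → 0ℚ ≤ d l) × (∑ d ≡ 1ℚ) ×
      (∀ x → Lin Q x → ⟪ ψ , x ⟫ ≡ ∑ (λ l → d l * ⟪ Φ l , x ⟫))
  represent ψ ψ≤1 = d , d≥0 , ∑d≡1 , λ x x∈lin → trans (agree x x∈lin)
      (trans (⟪⟫-cong {c = x} φ≡ (λ _ → refl)) (⟪⟫-∑ˡ x d Φ))
    where
    rep = proj₁ (proj₂ (proj₂ (proj₂ R)) ψ) (conv-bound ψ ψ≤1)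
    φ = proj₁ rep
    d = proj₁ (proj₁ (proj₂ rep))
    d≥0 = proj₁ (proj₂ (proj₁ (proj₂ rep)))
    ∑d≡1 = proj₁ (proj₂ (proj₂ (proj₁ (proj₂ rep))))
    φ≡ = proj₂ (proj₂ (proj₂ (proj₁ (proj₂ rep))))
    agree = proj₂ (proj₂ rep)

  -- If a lattice point w of Q can be stretched to (1+ε)w ∈ Q, then every Φ_l
  -- is ≤ 0 on w: Φ_l(w) is an integer and (1+ε)Φ_l(w) ≤ 1.
  dual-nonpos : ∀ l {w} → IsLattice w → Conv Q w →
    ∀ {ε} → 0ℚ < ε → Conv Q (λ j → (1ℚ + ε) * w j) → ⟪ Φ l , w ⟫ ≤ 0ℚ
  dual-nonpos l {w} w-lattice w∈Q {ε} 0<ε stretched∈Q = by-integrality (integer-≤0⊎≥1 z)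
    where
    integrality = Φ-integral l w (conv⊆lin w∈Q) w-lattice
    z = proj₁ integrality
    Φw≡z = proj₂ integrality
    by-integrality : ℤ→ℚ z ≤ 0ℚ ⊎ 1ℚ ≤ ℤ→ℚ z → ⟪ Φ l , w ⟫ ≤ 0ℚ
    by-integrality (inj₁ z≤0) = subst (_≤ 0ℚ) (sym Φw≡z) z≤0
    by-integrality (inj₂ 1≤z) = ⊥-elim (≤<⇒⊥ stretched≤1 1<stretched)
      where
      X = ⟪ Φ l , w ⟫
      stretched≤1 : (1ℚ + ε) * X ≤ 1ℚ
      stretched≤1 = subst (_≤ 1ℚ) (⟪⟫-scaleʳ (Φ l) w (1ℚ + ε)) (Φ≤1 l _ stretched∈Q)
      1<stretched : 1ℚ < (1ℚ + ε) * X
      1<stretched = 0<-⇒< (subst (0ℚ <_) (sym (expand ε X))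
        (0<+ 0<ε (0≤* (QP.<⇒≤ (0<+ 0<1 (QP.<⇒≤ 0<ε))) (≤⇒0≤- (subst (1ℚ ≤_) (sym Φw≡z) 1≤z)))))
        where expand : ∀ e X → (1ℚ + e) * X - 1ℚ ≡ e + (1ℚ + e) * (X - 1ℚ)
              expand = solve-∀ ℚ-ring

  -- The only point of lin Q on which every Φ_l is ≤ 0 is 0: a small multiple
  -- εw is ≤ 1 on Q, so ε⟪w,w⟫ = ⟪εw,w⟫ is a convex combination of the Φ_l(w).
  nonpos⇒zero : ∀ {w} → Lin Q w → (∀ l → ⟪ Φ l , w ⟫ ≤ 0ℚ) → ∀ j → w j ≡ 0ℚ
  nonpos⇒zero {w} w∈lin Φw≤0 = ⟪⟫-self-zero w (QP.≤-antisym ww≤0 (⟪⟫-self-nonneg w))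
    where
    factor = small-factor 0<1 (∑-nonneg (λ i → QP.0≤∣p∣ ⟪ w , Q i ⟫))
    ε = proj₁ factor
    0<ε = proj₁ (proj₂ factor)
    ψ : Vecℚ n
    ψ j = ε * w j
    ψ≤1 : ∀ i → ⟪ ψ , Q i ⟫ ≤ 1ℚ
    ψ≤1 i = subst (_≤ 1ℚ) (sym (⟪⟫-scaleˡ w (Q i) ε))
      (QP.<⇒≤ (proj₂ (small-multiple (QP.<⇒≤ 0<ε) (term≤∑ (λ i → QP.0≤∣p∣ ⟪ w , Q i ⟫) i)
                                      (proj₂ (proj₂ factor)))))
    rep = represent ψ ψ≤1
    d = proj₁ rep
    εww≤0 : ε * ⟪ w , w ⟫ ≤ 0ℚ
    εww≤0 = subst₂ _≤_ (trans (sym (proj₂ (proj₂ (proj₂ rep)) w w∈lin)) (⟪⟫-scaleˡ w w ε)) (∑-0 {#Φ})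
      (∑-mono (λ l → subst (d l * ⟪ Φ l , w ⟫ ≤_) (QP.*-zeroʳ (d l))
        (QP.*-monoˡ-≤-nonNeg (d l) {{Q.nonNegative (proj₁ (proj₂ rep) l)}} (Φw≤0 l))))
    ww≤0 : ⟪ w , w ⟫ ≤ 0ℚ
    ww≤0 = 0<*≤0⇒≤0 0<ε εww≤0

  supporting-facet : (θ : Vecℚ n) → (∀ i → ⟪ θ , Q i ⟫ ≤ 1ℚ) →
    ∀ {b} → Conv Q b → ⟪ θ , b ⟫ ≡ 1ℚ → Σ (Fin #Φ) λ l → ⟪ Φ l , b ⟫ ≡ 1ℚ
  supporting-facet θ θ≤1 {b} b∈Q θb≡1 =
    average-attains d (λ l → ⟪ Φ l , b ⟫) d≥0 ∑d≡1 (λ l → Φ≤1 l b b∈Q)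
      (trans (sym (θ≡ b (conv⊆lin b∈Q))) θb≡1)
    where
    rep = represent θ θ≤1
    d = proj₁ rep
    d≥0 = proj₁ (proj₂ rep)
    ∑d≡1 = proj₁ (proj₂ (proj₂ rep))
    θ≡ = proj₂ (proj₂ (proj₂ rep))

-- This is Farkas'
-- lemma for -α(p) and the generators -Y, α(v_1), …, α(v_r): a representation
-- -α(p) = c₀·(-Y) + ∑ c_i α(v_i) would put x - (l + 1/c₀)·α(p) in the cone.
maximal-shift-separator : ∀ {n r} (v : Fin r → Vecℚ n) (p : Vecℚ n) {x : Vecℚ (suc n)} {l : ℚ} →
  ConeOf v (shiftDown x l p) → (∀ μ → ConeOf v (shiftDown x μ p) → μ ≤ l) →
  Σ (Vecℚ (suc n)) λ ψ →
    (∀ i → 0ℚ ≤ ⟪ ψ , α (v i) ⟫) × (0ℚ < ⟪ ψ , α p ⟫) × (⟪ ψ , shiftDown x l p ⟫ ≤ 0ℚ)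
maximal-shift-separator {n} {r} v p {x} {l} Y∈C maximal = separate (farkas (suc r) G g)
  where
  Y : Vecℚ (suc n)
  Y = shiftDown x l p
  G : Fin (suc r) → Vecℚ (suc n)
  G zero j = - Y j
  G (suc i) = α (v i)
  g : Vecℚ (suc n)
  g j = - α p j

  no-representation : InCone G g → ⊥
  no-representation (c , c≥0 , g≡) = ≤<⇒⊥ (maximal (l + μ) beyond∈C) l<l+μ
    where
    c₀ = c zero
    D : Vecℚ (suc n)
    D j = ∑ (λ i → c (suc i) * α (v i) j)
    c₀Y-αp≡D : ∀ j → c₀ * Y j - α p j ≡ D j
    c₀Y-αp≡D j = trans (cong (c₀ * Y j +_) (g≡ j)) (cancel c₀ (Y j) (D j))
      where cancel : ∀ c y d → c * y + (c * (- y) + d) ≡ d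
            cancel = solve-∀ ℚ-ring
    -- in the last coordinate c₀ = 0 would give -1 = ∑ c_i ≥ 0
    0≤D-last : 0ℚ ≤ D (fromℕ n)
    0≤D-last = ∑-nonneg (λ i → 0≤* (c≥0 (suc i)) (subst (0ℚ ≤_) (sym (snoc-last (v i) 1ℚ)) (QP.<⇒≤ 0<1)))
    c₀≢0 : c₀ ≢ 0ℚ
    c₀≢0 c₀≡0 = ≤<⇒⊥ 0≤D-last (subst₂ _<_ -1≡D refl (QP.neg-antimono-< 0<1))
      where
      L = fromℕ n
      -1≡D : - 1ℚ ≡ D L
      -1≡D = begin
        - 1ℚ                ≡⟨ cong -_ (sym (snoc-last p 1ℚ)) ⟩
        - α p L             ≡⟨ sym (zero-left (Y L) (α p L)) ⟩
        0ℚ * Y L - α p L    ≡⟨ cong (λ t → t * Y L - α p L) (sym c₀≡0) ⟩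
        c₀ * Y L - α p L    ≡⟨ c₀Y-αp≡D L ⟩
        D L                 ∎
        where open ≡-Reasoning
              zero-left : ∀ y P → 0ℚ * y - P ≡ - P
              zero-left = solve-∀ ℚ-ring
    0<c₀ = 0≤∧≢0⇒0< (c≥0 zero) c₀≢0
    μ = inv c₀ c₀≢0
    0<μ = inv-pos c₀ c₀≢0 0<c₀
    beyond≡ : ∀ j → shiftDown x (l + μ) p j ≡ ∑ (λ i → (μ * c (suc i)) * α (v i) j)
    beyond≡ j = begin
      x j - (l + μ) * α p j                ≡⟨ factor μ c₀ (x j) l (α p j) (trans (QP.*-comm μ c₀) (*-inv c₀ c₀≢0)) ⟩
      μ * (c₀ * Y j - α p j)               ≡⟨ cong (μ *_) (c₀Y-αp≡D j) ⟩
      μ * D j                              ≡⟨ sym (∑-*ˡ μ (λ i → c (suc i) * α (v i) j)) ⟩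
      ∑ (λ i → μ * (c (suc i) * α (v i) j)) ≡⟨ ∑-cong (λ i → sym (QP.*-assoc μ (c (suc i)) (α (v i) j))) ⟩
      ∑ (λ i → (μ * c (suc i)) * α (v i) j) ∎
      where open ≡-Reasoning
            factor : ∀ μ c x l P → μ * c ≡ 1ℚ → x - (l + μ) * P ≡ μ * (c * (x - l * P) - P)
            factor μ c x l P h = trans (expand μ x l P) (trans (cong (λ t → t * (x - l * P) - μ * P) (sym h)) (regroup μ c x l P))
              where expand : ∀ μ x l P → x - (l + μ) * P ≡ 1ℚ * (x - l * P) - μ * P
                    expand = solve-∀ ℚ-ring
                    regroup : ∀ μ c x l P → (μ * c) * (x - l * P) - μ * P ≡ μ * (c * (x - l * P) - P)
                    regroup = solve-∀ ℚ-ring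
    beyond∈C : ConeOf v (shiftDown x (l + μ) p)
    beyond∈C = cone-combination v (proj₁ (proj₂ (proj₂ (proj₂ Y∈C))))
                 (λ i → μ * c (suc i)) (λ i → 0≤* (QP.<⇒≤ 0<μ) (c≥0 (suc i))) beyond≡
    l<l+μ : l < l + μ
    l<l+μ = subst₂ _<_ (QP.+-identityʳ l) refl (QP.+-monoʳ-< l 0<μ)

  separate : InCone G g ⊎ Separates G g →
    Σ (Vecℚ (suc n)) λ ψ → (∀ i → 0ℚ ≤ ⟪ ψ , α (v i) ⟫) × (0ℚ < ⟪ ψ , α p ⟫) × (⟪ ψ , Y ⟫ ≤ 0ℚ)
  separate (inj₁ representation) = ⊥-elim (no-representation representation)
  separate (inj₂ (ψ , ψG≥0 , ψg<0)) =
    ψ , ψG≥0 ∘ suc ,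
    -<0⇒0< (subst (_< 0ℚ) (⟪⟫-negʳ ψ (α p)) ψg<0) ,
    0≤-⇒≤0 (subst (0ℚ ≤_) (⟪⟫-negʳ ψ Y) (ψG≥0 zero))

-- A separator as above vanishes at the point a ∈ P with Y = t·α(a), t > 0:
-- ⟪ψ,α(a)⟫ is an average of the values ⟪ψ,α(v_i)⟫ ≥ 0, while t·⟪ψ,α(a)⟫ = ⟪ψ,Y⟫ ≤ 0.
separator-vanishes : ∀ {n r} (v : Fin r → Vecℚ n) (ψ : Vecℚ (suc n)) → (∀ i → 0ℚ ≤ ⟪ ψ , α (v i) ⟫) →
  ∀ {Y t a} → 0ℚ < t → Conv v a → (∀ j → Y j ≡ t * α a j) → ⟪ ψ , Y ⟫ ≤ 0ℚ → ⟪ ψ , α a ⟫ ≡ 0ℚ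
separator-vanishes v ψ ψv≥0 {Y} {t} {a} 0<t (e , e≥0 , ∑e≡1 , a≡) Y≡ ψY≤0 = QP.≤-antisym ψαa≤0 0≤ψαa
  where
  αa≡ : ∀ j → α a j ≡ ∑ (λ i → e i * α (v i) j)
  αa≡ j = trans (snoc-cong a≡ refl j) (α-∑ e v ∑e≡1 j)
  0≤ψαa : 0ℚ ≤ ⟪ ψ , α a ⟫
  0≤ψαa = subst (0ℚ ≤_) (sym (trans (⟪⟫-cong {a = ψ} (λ _ → refl) αa≡) (⟪⟫-∑ʳ ψ e (λ i → α (v i)))))
            (∑-nonneg (λ i → 0≤* (e≥0 i) (ψv≥0 i)))
  ψαa≤0 : ⟪ ψ , α a ⟫ ≤ 0ℚ
  ψαa≤0 = 0<*≤0⇒≤0 0<t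
    (subst (_≤ 0ℚ) (trans (⟪⟫-cong {a = ψ} (λ _ → refl) Y≡) (⟪⟫-scaleʳ ψ (α a) t)) ψY≤0)

-- A point of the lower envelope is its own envelope point: y lies in the
-- cone, and a shift μ > 0 of y would be a shift l + μ of the original point.
lenv-fixed : ∀ {n r} (v : Fin r → Vecℚ n) (p : Vecℚ n) {y} →
  Lenv (ConeOf v) p y → ConeOf v y × IsEps (ConeOf v) p y y
lenv-fixed v p {y} (x , _ , l , Y∈C , maximal , y≡) = y∈C , 0ℚ , y₀∈C , 0-maximal , λ j → sym (unshifted j)
  where
  y∈C = cone-cong y≡ Y∈C
  unshifted : ∀ j → shiftDown y 0ℚ p j ≡ y j
  unshifted j = zero-shift (y j) (α p j)
    where zero-shift : ∀ a b → a - 0ℚ * b ≡ a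
          zero-shift = solve-∀ ℚ-ring
  y₀∈C = cone-cong unshifted y∈C
  0-maximal : ∀ μ → ConeOf v (shiftDown y μ p) → μ ≤ 0ℚ
  0-maximal μ yμ∈C = 0≤-⇒≤0 (subst (0ℚ ≤_) (difference l μ) (≤⇒0≤- (maximal (l + μ) (cone-cong composed yμ∈C))))
    where
    composed : ∀ j → shiftDown x (l + μ) p j ≡ shiftDown y μ p j
    composed j = trans (compose (x j) l μ (α p j)) (cong (λ t → t - μ * α p j) (sym (y≡ j)))
      where compose : ∀ x l μ P → x - (l + μ) * P ≡ (x - l * P) - μ * P
            compose = solve-∀ ℚ-ring
    difference : ∀ l μ → l - (l + μ) ≡ - μ
    difference = solve-∀ ℚ-ring

-- A Gorenstein polytope P = conv V of index k, with kP - m′ reflexive.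
-- Points of ℚ^n are written v (vertices of P), kv (of kP) and q (of kP - m′).
module Gorenstein {n r} (V : Fin r → Vecℤ n) (k′ : ℕ) (m′ : Vecℤ n)
  (reflexive : IsReflexive (shiftScale (suc k′) m′ V)) where

  K : ℚ
  K = ℤ→ℚ (Z.+ suc k′)

  v kv q : Fin r → Vecℚ n
  v = latticePts V
  kv = latticePts (scale (suc k′) V)
  q = latticePts (shiftScale (suc k′) m′ V)

  kv≡ : ∀ i j → kv i j ≡ K * v i j
  kv≡ i j = ℤ→ℚ-* (Z.+ suc k′) (V i j)

  q≡ : ∀ i j → q i j ≡ kv i j - ι m′ j
  q≡ i j = ℤ→ℚ-- (Z.+ suc k′ Z.* V i j) (m′ j)

  q≡Kv-m′ : ∀ i j → q i j ≡ K * v i j - ι m′ j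
  q≡Kv-m′ i j = trans (q≡ i j) (cong (_- ι m′ j) (kv≡ i j))

  open Translation kv q (ι m′) q≡
  open Reflexive q (proj₂ reflexive)

  -- m′ is the only lattice point in the relative interior of kP.  For
  -- w = m - m′ both w and (1+ε)w lie in kP - m′, so every facet functional
  -- is ≤ 0 on w, which forces w = 0.
  interior-point : ∀ {m} → RelInt kv (ι m) → ∀ j → ι m j ≡ ι m′ j
  interior-point {m} m∈relint = λ j → -0≡0⇒≡ (w≡0 j)
    where
    w : Vecℚ n
    w j = ι m j - ι m′ j
    w-lattice : IsLattice w
    w-lattice = (λ j → m j Z.- m′ j) , λ j → sym (ℤ→ℚ-- (m j) (m′ j))
    m′∈kP : Conv kv (ι m′)
    m′∈kP = conv-untranslate (λ j → sym (QP.+-inverseʳ (ι m′ j))) (proj₁ reflexive)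
    stretch = relint-stretch m∈relint m′∈kP
    ε = proj₁ stretch
    w∈Q : Conv q w
    w∈Q = conv-translate (λ _ → refl) (proj₁ m∈relint)
    stretched∈Q : Conv q (λ j → (1ℚ + ε) * w j)
    stretched∈Q = conv-translate (λ j → regroup ε (ι m j) (ι m′ j)) (proj₂ (proj₂ stretch))
      where regroup : ∀ e m m′ → (1ℚ + e) * (m - m′) ≡ (m + e * (m - m′)) - m′
            regroup = solve-∀ ℚ-ring
    w≡0 : ∀ j → w j ≡ 0ℚ
    w≡0 = nonpos⇒zero (conv⊆lin w∈Q)
            (λ l → dual-nonpos l w-lattice w∈Q (proj₁ (proj₂ stretch)) stretched∈Q)

  module Envelope (p : Vecℚ n) (Kp≡m′ : ∀ j → K * p j ≡ ι m′ j) where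

    0<K : 0ℚ < K
    0<K = 0<suc k′

    -- Dehomogenising a separator ψ gives a functional θ ≤ 1 on kP - m′
    -- with θ(K·a - m′) = 1 - ⟪ψ,α(a)⟫/⟪ψ,α(p)⟫; in particular θ(K·a - m′) = 1
    -- wherever ψ vanishes on α(a).
    dehomogenise : (ψ : Vecℚ (suc n)) → (∀ i → 0ℚ ≤ ⟪ ψ , α (v i) ⟫) → 0ℚ < ⟪ ψ , α p ⟫ →
      Σ (Vecℚ n) λ θ → (∀ i → ⟪ θ , q i ⟫ ≤ 1ℚ) ×
        (∀ a → ⟪ ψ , α a ⟫ ≡ 0ℚ → ⟪ θ , (λ j → K * a j - ι m′ j) ⟫ ≡ 1ℚ)
    dehomogenise ψ ψv≥0 0<ψp = θ , θq≤1 , θ-tight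
      where
      f : Vecℚ n → ℚ
      f a = ⟪ ψ , α a ⟫
      ψ′ : Vecℚ n
      ψ′ j = ψ (inject₁ j)
      β = K * f p
      β≢0 = 0<⇒≢0 (0<* 0<K 0<ψp)
      β⁻¹ = inv β β≢0
      θ : Vecℚ n
      θ j = (- β⁻¹) * ψ′ j
      θ-at : ∀ a → ⟪ θ , (λ j → K * a j - ι m′ j) ⟫ ≡ 1ℚ - (K * f a) * β⁻¹
      θ-at a = begin
        ⟪ θ , (λ j → K * a j - ι m′ j) ⟫
          ≡⟨ ⟪⟫-cong {a = θ} (λ _ → refl) (λ j → cong (λ s → K * a j - s) (sym (Kp≡m′ j))) ⟩
        ⟪ θ , (λ j → K * a j - K * p j) ⟫
          ≡⟨ ⟪⟫-linear⁻ʳ θ a p K K ⟩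
        K * ⟪ θ , a ⟫ - K * ⟪ θ , p ⟫
          ≡⟨ cong₂ (λ s s′ → K * s - K * s′) (⟪⟫-scaleˡ ψ′ a (- β⁻¹)) (⟪⟫-scaleˡ ψ′ p (- β⁻¹)) ⟩
        K * ((- β⁻¹) * ⟪ ψ′ , a ⟫) - K * ((- β⁻¹) * ⟪ ψ′ , p ⟫)
          ≡⟨ cong₂ (λ s s′ → K * ((- β⁻¹) * s) - K * ((- β⁻¹) * s′)) (affine a) (affine p) ⟩
        K * ((- β⁻¹) * (f a - ψ (fromℕ n))) - K * ((- β⁻¹) * (f p - ψ (fromℕ n)))
          ≡⟨ regroup K β⁻¹ (f a) (f p) (ψ (fromℕ n)) ⟩
        β * β⁻¹ - (K * f a) * β⁻¹
          ≡⟨ cong (_- (K * f a) * β⁻¹) (*-inv β β≢0) ⟩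
        1ℚ - (K * f a) * β⁻¹ ∎
        where
        open ≡-Reasoning
        affine : ∀ a → ⟪ ψ′ , a ⟫ ≡ f a - ψ (fromℕ n)
        affine a = sym (trans (cong (_- ψ (fromℕ n)) (⟪⟫-α ψ a)) (cancel ⟪ ψ′ , a ⟫ (ψ (fromℕ n))))
          where cancel : ∀ s c → (s + c) - c ≡ s
                cancel = solve-∀ ℚ-ring
        regroup : ∀ K c A P L → K * ((- c) * (A - L)) - K * ((- c) * (P - L)) ≡ (K * P) * c - (K * A) * c
        regroup = solve-∀ ℚ-ring
      θq≤1 : ∀ i → ⟪ θ , q i ⟫ ≤ 1ℚ
      θq≤1 i = subst (_≤ 1ℚ) (sym (trans (⟪⟫-cong {a = θ} (λ _ → refl) (q≡Kv-m′ i)) (θ-at (v i))))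
        (-nonneg-≤ (0≤* (0≤* (QP.<⇒≤ 0<K) (ψv≥0 i)) (QP.<⇒≤ (inv-pos β β≢0 (0<* 0<K 0<ψp)))))
      θ-tight : ∀ a → f a ≡ 0ℚ → ⟪ θ , (λ j → K * a j - ι m′ j) ⟫ ≡ 1ℚ
      θ-tight a fa≡0 = trans (θ-at a) (trans (cong (λ s → 1ℚ - (K * s) * β⁻¹) fa≡0) (vanish K β⁻¹))
        where vanish : ∀ K c → 1ℚ - (K * 0ℚ) * c ≡ 1ℚ
              vanish = solve-∀ ℚ-ring

    -- For a lattice point x = T·α(aₓ) of the cone and a vertex v_i, the vector
    -- u = T·(aₓ - v_i) is a lattice point of lin(kP - m′): its coordinates are
    -- x_j - x_last·v_ij, and it is T/K times a difference of points of kP.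
    lattice-chord : ∀ {x T aₓ} → Conv v aₓ → (∀ j → x j ≡ T * α aₓ j) → IsLattice x → ∀ i →
      IsLattice (λ j → T * aₓ j - T * v i j) × Lin q (λ j → T * aₓ j - T * v i j)
    lattice-chord {x} {T} {aₓ} aₓ∈P x≡ (X , x≡X) i = u-lattice , u∈lin
      where
      L = fromℕ n
      u-lattice : IsLattice (λ j → T * aₓ j - T * v i j)
      u-lattice = (λ j → X (inject₁ j) Z.- X L Z.* V i j) , λ j →
        trans (cong₂ (λ s s′ → s - s′ * v i j) (trans (sym (scaled-α-init {t = T} {aₓ} x≡ j)) (x≡X (inject₁ j)))
                                               (trans (sym (scaled-α-last {t = T} {aₓ} x≡)) (x≡X L)))
              (sym (trans (ℤ→ℚ-- (X (inject₁ j)) (X L Z.* V i j))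
                          (cong (λ s → ι X (inject₁ j) - s) (ℤ→ℚ-* (X L) (V i j)))))
      K≢0 = 0<⇒≢0 0<K
      K⁻¹ = inv K K≢0
      rescale : ∀ j → T * aₓ j - T * v i j ≡ (T * K⁻¹) * (K * aₓ j - kv i j)
      rescale j = begin
        T * aₓ j - T * v i j                      ≡⟨ sym (QP.*-identityʳ _) ⟩
        (T * aₓ j - T * v i j) * 1ℚ               ≡⟨ cong ((T * aₓ j - T * v i j) *_) (sym (*-inv K K≢0)) ⟩
        (T * aₓ j - T * v i j) * (K * K⁻¹)        ≡⟨ regroup T K K⁻¹ (aₓ j) (v i j) ⟩
        (T * K⁻¹) * (K * aₓ j - K * v i j)        ≡⟨ cong (λ s → (T * K⁻¹) * (K * aₓ j - s)) (sym (kv≡ i j)) ⟩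
        (T * K⁻¹) * (K * aₓ j - kv i j)           ∎
        where open ≡-Reasoning
              regroup : ∀ T K K⁻¹ A V → (T * A - T * V) * (K * K⁻¹) ≡ (T * K⁻¹) * (K * A - K * V)
              regroup = solve-∀ ℚ-ring
      u∈lin : Lin q (λ j → T * aₓ j - T * v i j)
      u∈lin = lin-cong rescale (lin-difference (conv-scale K kv≡ aₓ∈P) (vertex∈conv kv i) (T * K⁻¹))

    -- Shifting a lattice point by an integer multiple of K·α(p) = (m′, K)
    -- gives a lattice point.
    integer-shift : ∀ {x} → IsLattice x → (z : ℤ) → IsLattice (shiftDown x (- (K * ℤ→ℚ z)) p)
    integer-shift {x} (X , x≡X) z = (λ j → X j Z.+ z Z.* mK j) , λ j → begin
      x j - (- (K * ℤ→ℚ z)) * α p j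
        ≡⟨ cong (λ s → s - (- (K * ℤ→ℚ z)) * α p j) (x≡X j) ⟩
      ι X j - (- (K * ℤ→ℚ z)) * α p j
        ≡⟨ regroup (ι X j) K (ℤ→ℚ z) (α p j) ⟩
      ι X j + ℤ→ℚ z * (K * α p j)
        ≡⟨ cong (λ s → ι X j + ℤ→ℚ z * s) (Kαp≡ j) ⟩
      ι X j + ℤ→ℚ z * ι mK j
        ≡⟨ sym (trans (ℤ→ℚ-+ (X j) (z Z.* mK j)) (cong (ι X j +_) (ℤ→ℚ-* z (mK j)))) ⟩
      ℤ→ℚ (X j Z.+ z Z.* mK j) ∎
      where
      open ≡-Reasoning
      mK = snocℤ m′ (Z.+ suc k′)
      Kαp≡ : ∀ j → K * α p j ≡ ι mK j
      Kαp≡ = snoc-ext (λ j → K * α p j) (ι mK)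
        (λ j → trans (cong (K *_) (snoc-inject₁ p 1ℚ j))
                 (trans (Kp≡m′ j) (sym (trans (ι-snocℤ m′ _ (inject₁ j)) (snoc-inject₁ (ι m′) _ j)))))
        (trans (cong (K *_) (snoc-last p 1ℚ))
          (trans (QP.*-identityʳ K) (sym (trans (ι-snocℤ m′ _ (fromℕ n)) (snoc-last (ι m′) K)))))
      regroup : ∀ x K z P → x - (- (K * z)) * P ≡ x + z * (K * P)
      regroup = solve-∀ ℚ-ring

    -- Let the lattice point x = T·α(aₓ) be shifted to
    -- Y = x - l·α(p) = t·α(a), and let a dual-lattice functional φ equal 1 at
    -- K·a - m′ and at a vertex q_i.  With u = T·(aₓ - v_i) one has
    -- t·(K·a - m′) = K·u + T·q_i, so t = K·φ(u) + T and l = T - t = -K·φ(u).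
    shift-is-integral : (φ : Vecℚ n) → InDualLattice q φ → ∀ i → ⟪ φ , q i ⟫ ≡ 1ℚ →
      ∀ {x l t a} → ConeOf v x → IsLattice x → (∀ j → shiftDown x l p j ≡ t * α a j) →
      ⟪ φ , (λ j → K * a j - ι m′ j) ⟫ ≡ 1ℚ → Σ ℤ λ z → l ≡ - (K * ℤ→ℚ z)
    shift-is-integral φ φ-integral i φq≡1 {x} {l} {t} {a} (T , aₓ , _ , aₓ∈P , x≡) x-lattice Y≡ φb≡1 =
      z , l≡
      where
      u : Vecℚ n
      u j = T * aₓ j - T * v i j
      chord = lattice-chord {T = T} aₓ∈P x≡ x-lattice i
      integrality = φ-integral u (proj₂ chord) (proj₁ chord)
      z = proj₁ integrality
      coordinates = shift-coordinates {p = p} {l} {t} {T} {a} {aₓ} x≡ Y≡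
      Y-init = proj₁ coordinates
      Y-last = proj₂ coordinates
      decomposition : ∀ j → t * (K * a j - ι m′ j) ≡ K * u j + T * q i j
      decomposition j = begin
        t * (K * a j - ι m′ j)                          ≡⟨ cong (λ s → t * (K * a j - s)) (sym (Kp≡m′ j)) ⟩
        t * (K * a j - K * p j)                         ≡⟨ expand t K (a j) (p j) ⟩
        K * (t * a j) - t * (K * p j)                   ≡⟨ cong₂ (λ s s′ → K * s - s′ * (K * p j)) (Y-init j) Y-last ⟩
        K * (T * aₓ j - l * p j) - (T - l) * (K * p j)  ≡⟨ regroup K T (aₓ j) (v i j) l (p j) ⟩
        K * u j + T * (K * v i j - K * p j)             ≡⟨ cong (λ s → K * u j + T * (K * v i j - s)) (Kp≡m′ j) ⟩
        K * u j + T * (K * v i j - ι m′ j)              ≡⟨ cong (λ s → K * u j + T * s)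
                                                              (sym (q≡Kv-m′ i j)) ⟩
        K * u j + T * q i j                             ∎
        where open ≡-Reasoning
              expand : ∀ t K A P → t * (K * A - K * P) ≡ K * (t * A) - t * (K * P)
              expand = solve-∀ ℚ-ring
              regroup : ∀ K T A V l P →
                K * (T * A - l * P) - (T - l) * (K * P) ≡ K * (T * A - T * V) + T * (K * V - K * P)
              regroup = solve-∀ ℚ-ring
      t≡ : t ≡ K * ℤ→ℚ z + T
      t≡ = begin
        t                                         ≡⟨ sym (QP.*-identityʳ t) ⟩
        t * 1ℚ                                    ≡⟨ cong (t *_) (sym φb≡1) ⟩
        t * ⟪ φ , (λ j → K * a j - ι m′ j) ⟫      ≡⟨ sym (⟪⟫-scaleʳ φ _ t) ⟩
        ⟪ φ , (λ j → t * (K * a j - ι m′ j)) ⟫    ≡⟨ ⟪⟫-cong {a = φ} (λ _ → refl) decomposition ⟩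
        ⟪ φ , (λ j → K * u j + T * q i j) ⟫       ≡⟨ ⟪⟫-linear φ u (q i) K T ⟩
        K * ⟪ φ , u ⟫ + T * ⟪ φ , q i ⟫           ≡⟨ cong₂ (λ s s′ → K * s + T * s′) (proj₂ integrality) φq≡1 ⟩
        K * ℤ→ℚ z + T * 1ℚ                        ≡⟨ cong (K * ℤ→ℚ z +_) (QP.*-identityʳ T) ⟩
        K * ℤ→ℚ z + T                             ∎
        where open ≡-Reasoning
      l≡ : l ≡ - (K * ℤ→ℚ z)
      l≡ = trans (sym (solve-l l T)) (trans (cong (λ s → T - s) (trans (sym Y-last) t≡)) (cancel (K * ℤ→ℚ z) T))
        where solve-l : ∀ l T → T - (T - l) ≡ l
              solve-l = solve-∀ ℚ-ring
              cancel : ∀ w T → T - (w + T) ≡ - w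
              cancel = solve-∀ ℚ-ring

    -- Write the
    -- maximal shift as Y = x - l·α(p) = t·α(a).  If t = 0 then Y = 0.  Otherwise
    -- a separator ψ vanishes at a, and its dehomogenisation θ equals 1 at
    -- K·a - m′ ∈ kP - m′; hence some facet functional Φ_l₀ equals 1 there and
    -- at a vertex q_i₀, and the integrality step makes l ∈ Kℤ.
    envelope-lattice : ∀ {x l} → ConeOf v x → IsLattice x → ConeOf v (shiftDown x l p) →
      (∀ μ → ConeOf v (shiftDown x μ p) → μ ≤ l) → IsLattice (shiftDown x l p)
    envelope-lattice {x} {l} x∈C x-lattice Y∈C@(t , a , 0≤t , a∈P , Y≡) maximal = by-height (t QP.≟ 0ℚ)
      where
      by-height : Dec (t ≡ 0ℚ) → IsLattice (shiftDown x l p)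
      by-height (yes t≡0) = (λ _ → Z.0ℤ) , λ j → trans (Y≡ j) (trans (cong (_* α a j) t≡0) (QP.*-zeroˡ (α a j)))
      by-height (no t≢0) =
        subst (λ s → IsLattice (shiftDown x s p)) (sym (proj₂ l∈Kℤ)) (integer-shift x-lattice (proj₁ l∈Kℤ))
        where
        separator = maximal-shift-separator v p {x} Y∈C maximal
        ψ = proj₁ separator
        ψv≥0 = proj₁ (proj₂ separator)
        ψa≡0 = separator-vanishes v ψ ψv≥0 {shiftDown x l p} (0≤∧≢0⇒0< 0≤t t≢0) a∈P Y≡
                 (proj₂ (proj₂ (proj₂ separator)))
        θ = dehomogenise ψ ψv≥0 (proj₁ (proj₂ (proj₂ separator)))
        b∈Q : Conv q (λ j → K * a j - ι m′ j)
        b∈Q = conv-translate (λ _ → refl) (conv-scale K kv≡ a∈P)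
        facet = supporting-facet (proj₁ θ) (proj₁ (proj₂ θ)) b∈Q (proj₂ (proj₂ θ) a ψa≡0)
        l₀ = proj₁ facet
        vertex = tight-vertex (Φ l₀) (λ i → Φ≤1 l₀ (q i) (vertex∈conv q i)) b∈Q (proj₂ facet)
        l∈Kℤ = shift-is-integral (Φ l₀) (Φ-integral l₀) (proj₁ vertex) (proj₂ vertex)
                 {x} {l} {t} {a} x∈C x-lattice Y≡ (proj₂ facet)

proposition5p8 : (n r : ℕ) (V : Fin r → Vecℤ n) (k : ℕ) .{{_ : NonZero k}} →
    IsGorensteinOfIndex V k →
    (m : Vecℤ n) → RelInt (latticePts (scale k V)) (ι m) →
    (y : Vecℚ (suc n)) →
      (LLenv (ConeOf (latticePts V)) (λ j → m j / k) y →
        Lenv (ConeOf (latticePts V)) (λ j → m j / k) y × IsLattice y)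
      × (Lenv (ConeOf (latticePts V)) (λ j → m j / k) y × IsLattice y →
        LLenv (ConeOf (latticePts V)) (λ j → m j / k) y)
proposition5p8 n r V zero {{k≢0}} _ _ _ _ = ⊥-elim-irr (ℕ.NonZero.nonZero k≢0)
proposition5p8 n r V (suc k′) (m′ , reflexive) m m∈relint y = llenv⊆lenv∩ℤ , lenv∩ℤ⊆llenv
  where
  open Gorenstein V k′ m′ reflexive
  p : Vecℚ n
  p j = m j / suc k′
  -- m is the point m′ of the Gorenstein condition, so K·p = m′
  Kp≡m′ : ∀ j → K * p j ≡ ι m′ j
  Kp≡m′ j = trans (*-/-cancel k′ (m j)) (interior-point {m} m∈relint j)
  open Envelope p Kp≡m′

  llenv⊆lenv∩ℤ : LLenv (ConeOf v) p y → Lenv (ConeOf v) p y × IsLattice y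
  llenv⊆lenv∩ℤ (x , x∈C , x-lattice , l , Y∈C , maximal , y≡) =
    (x , x∈C , l , Y∈C , maximal , y≡) ,
    (proj₁ Y-lattice , λ j → trans (y≡ j) (proj₂ Y-lattice j))
    where Y-lattice = envelope-lattice x∈C x-lattice Y∈C maximal

  lenv∩ℤ⊆llenv : Lenv (ConeOf v) p y × IsLattice y → LLenv (ConeOf v) p y
  lenv∩ℤ⊆llenv (y∈lenv , y-lattice) = y , proj₁ fixed , y-lattice , proj₂ fixed
    where fixed = lenv-fixed v p y∈lenv
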